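{- For every $n\geq 3$, the $n$-dimensional hypercube $H_n$, viewed as an instance of Bipartite Influence, satisfies $H_n=0$ (its game is equivalent to the zero game).
   Context: $H_n$ has vertex set $\{0,1\}^n$, two vertices adjacent iff they differ in exactly one coordinate; vertices with an odd number of nonzero coordinates are black, the others white. Bipartite Influence: Left picks a black vertex, Right a white vertex; playing $v$ removes $v$, its neighbours and all vertices that become isolated, credited to the mover; the score is (Left's vertices) minus (Right's vertices). A graph $G$ satisfies $G=0$ if $Ls(G+X)=Ls(X)$ and $Rs(G+X)=Rs(X)$ for every dicotic nonzugzwang scoring game $X$, where $Ls$/$Rs$ is the optimal score with Left/Right starting and $+$ is the disjunctive sum; dicotic means every position has Left options iff it has Right options, nonzugzwang means $Ls(P)\ge Rs(P)$ at every position $P$. -}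

module Defs where

open import Data.Bool using (Bool; true; false; not; _∧_; _∨_; _xor_; if_then_else_)
open import Data.Nat using (ℕ; zero; suc; _∸_; _≤ᵇ_)
import Data.Nat as ℕ
open import Data.Integer using (ℤ; +_; -_; _+_; _⊔_; _⊓_; _≤_)
open import Data.List using (List; []; _∷_; _++_; map; length; filterᵇ; null; [_])
open import Data.Bool.ListAction using (any)
open import Data.List.Relation.Unary.All using (All)
open import Data.Vec using (Vec; []; _∷_; foldr′; zipWith)
open import Data.Product using (_×_; _,_; proj₂)
open import Relation.Binary.PropositionalEquality using (_≡_)

-- A game is given by its Left options and Right options; each option is
-- a pair (d , G') where d is the score increment of that move
-- (points gained by Left minus points gained by Right) and G' the
-- resulting position.

data Game : Set where
  mk : List (ℤ × Game) → List (ℤ × Game) → Game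

-- Play ends when the player to move has no
-- move; in the dicotic universe used below this happens exactly when
-- neither player has a move.
mutual
  Ls : Game → ℤ
  Ls (mk [] _) = + 0
  Ls (mk ((d , g) ∷ L) _) = maxOpt (d + Rs g) L

  maxOpt : ℤ → List (ℤ × Game) → ℤ
  maxOpt a [] = a
  maxOpt a ((d , g) ∷ L) = maxOpt (a ⊔ (d + Rs g)) L

  Rs : Game → ℤ
  Rs (mk _ []) = + 0
  Rs (mk _ ((d , g) ∷ R)) = minOpt (d + Ls g) R

  minOpt : ℤ → List (ℤ × Game) → ℤ
  minOpt a [] = a
  minOpt a ((d , g) ∷ R) = minOpt (a ⊓ (d + Ls g)) R

mutual
  _⊕_ : Game → Game → Game
  G@(mk GL GR) ⊕ X@(mk XL XR) =
    mk (leftComp GL X ++ rightComp G XL) (leftComp GR X ++ rightComp G XR)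

  leftComp : List (ℤ × Game) → Game → List (ℤ × Game)
  leftComp [] X = []
  leftComp ((d , g) ∷ os) X = (d , g ⊕ X) ∷ leftComp os X

  rightComp : Game → List (ℤ × Game) → List (ℤ × Game)
  rightComp G [] = []
  rightComp G ((d , x) ∷ os) = (d , G ⊕ x) ∷ rightComp G os

data Dicotic : Game → Set where
  dicotic : ∀ {L R} → null L ≡ null R →
            All (λ o → Dicotic (proj₂ o)) L →
            All (λ o → Dicotic (proj₂ o)) R →
            Dicotic (mk L R)

data Nonzugzwang : Game → Set where
  nonzugzwang : ∀ {L R} → Rs (mk L R) ≤ Ls (mk L R) →
                All (λ o → Nonzugzwang (proj₂ o)) L →
                All (λ o → Nonzugzwang (proj₂ o)) R →
                Nonzugzwang (mk L R)

IsZero : Game → Set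
IsZero G = ∀ (X : Game) → Dicotic X → Nonzugzwang X →
           (Ls (G ⊕ X) ≡ Ls X) × (Rs (G ⊕ X) ≡ Rs X)

vertices : (n : ℕ) → List (Vec Bool n)
vertices zero = [ [] ]
vertices (suc n) = map (false ∷_) (vertices n) ++ map (true ∷_) (vertices n)

hamming : ∀ {n} → Vec Bool n → Vec Bool n → ℕ
hamming u v = foldr′ (λ b k → if b then suc k else k) 0 (zipWith _xor_ u v)

adjacent : ∀ {n} → Vec Bool n → Vec Bool n → Bool
adjacent u v = hamming u v ℕ.≡ᵇ 1

inClosedNbhd : ∀ {n} → Vec Bool n → Vec Bool n → Bool
inClosedNbhd v u = hamming u v ≤ᵇ 1

black : ∀ {n} → Vec Bool n → Bool
black v = foldr′ _xor_ false v

white : ∀ {n} → Vec Bool n → Bool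
white v = not (black v)

after : ∀ {n} → Vec Bool n → List (Vec Bool n) → List (Vec Bool n)
after v S =
  let S₁ = filterᵇ (λ u → not (inClosedNbhd v u)) S
  in filterᵇ (λ u → any (adjacent u) S₁) S₁

removed : ∀ {n} → Vec Bool n → List (Vec Bool n) → ℕ
removed v S = length S ∸ length (after v S)

-- The first argument is fuel; every move removes at least one
-- vertex, so fuel = length S suffices to build the full game tree.
influence : ∀ {n} → ℕ → List (Vec Bool n) → Game
influence zero S = mk [] []
influence (suc k) S =
  mk (map (λ v → (+ removed v S , influence k (after v S))) (filterᵇ black S))
     (map (λ v → (- (+ removed v S) , influence k (after v S))) (filterᵇ white S))

H : ℕ → Game
H n = influence (length (vertices n)) (vertices n)

-- The second player answers every move v by σ v, the vertex obtained from v by flipping its first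
-- three coordinates. σ is a colour-reversing automorphism of H_n moving every vertex to distance 3,
-- so the closed neighbourhoods of v and σ v are disjoint: σ v is still available after v, it
-- removes exactly as many vertices as v did, and the resulting position is again σ-invariant and
-- without isolated vertices. A game in which every move has such a score-cancelling answer, and
-- which is nonzugzwang at each answered position, vanishes in sums with dicotic games. That
-- positions of Bipartite Influence on H_n are nonzugzwang follows, by induction, from the
-- supermodularity of the number of surviving vertices: a black move removes no more vertices after
-- a white move than before it.

module Submission where

open import Defs

module Counting where

  open import Data.Bool using (Bool; true; false; not; _∧_; _∨_; T?)
  open import Data.Bool.Properties using (T-≡)
  open import Data.Bool.ListAction using (any)
  open import Data.Nat using (ℕ; suc; _+_; _≤_; _<_; z≤n; s≤s)
  open import Data.Nat.Properties
  open import Data.List using (List; []; _∷_; _++_; filterᵇ; length; map)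
  open import Data.List.Properties using (length-filter; length-++; filter-++)
  open import Data.List.Relation.Unary.Any using (here; there)
  import Data.List.Relation.Unary.Any.Properties as Any
  open import Data.List.Membership.Propositional using (_∈_; lose; find)
  open import Data.List.Membership.Propositional.Properties using (∈-filter⁺; ∈-filter⁻)
  open import Data.Product using (_×_; _,_; ∃)
  open import Function using (_∘_; Equivalence)
  open import Relation.Binary.PropositionalEquality

  open Equivalence using (to; from)

  module _ {A : Set} where

    count : (A → Bool) → List A → ℕ
    count p xs = length (filterᵇ p xs)

    filterᵇ-cong : ∀ {p q : A → Bool} xs → (∀ x → p x ≡ q x) → filterᵇ p xs ≡ filterᵇ q xs
    filterᵇ-cong [] p≗q = refl
    filterᵇ-cong {p} {q} (x ∷ xs) p≗q with p x | q x | p≗q x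
    ... | true  | true  | refl = cong (x ∷_) (filterᵇ-cong xs p≗q)
    ... | false | false | refl = filterᵇ-cong xs p≗q

    filterᵇ-filterᵇ : ∀ (p q : A → Bool) xs → filterᵇ q (filterᵇ p xs) ≡ filterᵇ (λ x → p x ∧ q x) xs
    filterᵇ-filterᵇ p q [] = refl
    filterᵇ-filterᵇ p q (x ∷ xs) with p x
    ... | false = filterᵇ-filterᵇ p q xs
    ... | true with q x
    ...   | true  = cong (x ∷_) (filterᵇ-filterᵇ p q xs)
    ...   | false = filterᵇ-filterᵇ p q xs

    filterᵇ-true : ∀ (xs : List A) → filterᵇ (λ _ → true) xs ≡ xs
    filterᵇ-true [] = refl
    filterᵇ-true (x ∷ xs) = cong (x ∷_) (filterᵇ-true xs)

    ∈-filterᵇ⁺ : ∀ (p : A → Bool) {x xs} → x ∈ xs → p x ≡ true → x ∈ filterᵇ p xs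
    ∈-filterᵇ⁺ p x∈xs px = ∈-filter⁺ (T? ∘ p) x∈xs (from T-≡ px)

    ∈-filterᵇ⁻ : ∀ (p : A → Bool) xs {x} → x ∈ filterᵇ p xs → x ∈ xs × p x ≡ true
    ∈-filterᵇ⁻ p xs x∈fxs with ∈-filter⁻ (T? ∘ p) x∈fxs
    ... | x∈xs , px = x∈xs , to T-≡ px

    filterᵇ-none : ∀ (p : A → Bool) xs → (∀ {x} → x ∈ xs → p x ≡ false) → filterᵇ p xs ≡ []
    filterᵇ-none p [] _ = refl
    filterᵇ-none p (x ∷ xs) ¬p rewrite ¬p (here refl) = filterᵇ-none p xs (λ x∈xs → ¬p (there x∈xs))

    filterᵇ≡[]⇒false : ∀ (p : A → Bool) {x} xs → filterᵇ p xs ≡ [] → x ∈ xs → p x ≡ false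
    filterᵇ≡[]⇒false p {x} xs none x∈xs with p x in px
    ... | false = refl
    ... | true with () ← subst (x ∈_) none (∈-filterᵇ⁺ p x∈xs px)

    any⁺ : ∀ (p : A → Bool) {x xs} → x ∈ xs → p x ≡ true → any p xs ≡ true
    any⁺ p x∈xs px = to T-≡ (Any.any⁺ p (lose x∈xs (from T-≡ px)))

    any⁻ : ∀ (p : A → Bool) xs → any p xs ≡ true → ∃ λ x → x ∈ xs × p x ≡ true
    any⁻ p xs anyp with find (Any.any⁻ p xs (from T-≡ anyp))
    ... | x , x∈xs , px = x , x∈xs , to T-≡ px

    count-cong : ∀ {p q : A → Bool} xs → (∀ x → p x ≡ q x) → count p xs ≡ count q xs
    count-cong xs p≗q = cong length (filterᵇ-cong xs p≗q)

    count-++ : ∀ (p : A → Bool) xs ys → count p (xs ++ ys) ≡ count p xs + count p ys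
    count-++ p xs ys = trans (cong length (filter-++ (T? ∘ p) xs ys)) (length-++ (filterᵇ p xs))

    count-mono : ∀ (p q : A → Bool) xs → (∀ x → p x ≡ true → q x ≡ true) → count p xs ≤ count q xs
    count-mono p q [] p⇒q = z≤n
    count-mono p q (x ∷ xs) p⇒q with p x in px | q x in qx
    ... | true  | true  = s≤s (count-mono p q xs p⇒q)
    ... | false | true  = m≤n⇒m≤1+n (count-mono p q xs p⇒q)
    ... | false | false = count-mono p q xs p⇒q
    ... | true  | false with trans (sym qx) (p⇒q x px)
    ...   | ()

    count-difference : ∀ (p q : A → Bool) xs → (∀ x → q x ≡ true → p x ≡ true) →
                       count p xs ≡ count q xs + count (λ x → p x ∧ not (q x)) xs
    count-difference p q [] q⇒p = refl
    count-difference p q (x ∷ xs) q⇒p with p x in px | q x in qx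
    ... | true  | true  = cong suc (count-difference p q xs q⇒p)
    ... | true  | false = trans (cong suc (count-difference p q xs q⇒p)) (sym (+-suc _ _))
    ... | false | false = count-difference p q xs q⇒p
    ... | false | true with trans (sym px) (q⇒p x qx)
    ...   | ()

    count-mono-< : ∀ (p q : A → Bool) {y} xs → (∀ x → q x ≡ true → p x ≡ true) →
                   y ∈ xs → p y ≡ true → q y ≡ false → count q xs < count p xs
    count-mono-< p q xs q⇒p y∈xs py qy = begin-strict
      count q xs                                      <⟨ m<m+n (count q xs) (0<count y∈xs) ⟩
      count q xs + count (λ x → p x ∧ not (q x)) xs   ≡⟨ count-difference p q xs q⇒p ⟨
      count p xs                                      ∎
      where
      open ≤-Reasoning
      0<count : ∀ {xs} → _ ∈ xs → 0 < count (λ x → p x ∧ not (q x)) xs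
      0<count {z ∷ zs} (here refl) rewrite py | qy = s≤s z≤n
      0<count {z ∷ zs} (there y∈zs) with p z ∧ not (q z)
      ... | true  = s≤s z≤n
      ... | false = 0<count y∈zs

    count-∨-∧ : ∀ (p q : A → Bool) xs →
                count p xs + count q xs ≡ count (λ x → p x ∨ q x) xs + count (λ x → p x ∧ q x) xs
    count-∨-∧ p q [] = refl
    count-∨-∧ p q (x ∷ xs) with p x | q x
    ... | true  | true  = cong suc (trans (+-suc _ _) (trans (cong suc (count-∨-∧ p q xs)) (sym (+-suc _ _))))
    ... | true  | false = cong suc (count-∨-∧ p q xs)
    ... | false | true  = trans (+-suc _ _) (cong suc (count-∨-∧ p q xs))
    ... | false | false = count-∨-∧ p q xs

    count≡0 : ∀ (p : A → Bool) xs → count p xs ≡ 0 → filterᵇ p xs ≡ []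
    count≡0 p [] _ = refl
    count≡0 p (x ∷ xs) c≡0 with p x
    ... | false = count≡0 p xs c≡0

    count≤length : ∀ (p : A → Bool) xs → count p xs ≤ length xs
    count≤length p = length-filter (T? ∘ p)

    count-false : ∀ (xs : List A) → count (λ _ → false) xs ≡ 0
    count-false [] = refl
    count-false (x ∷ xs) = count-false xs

  count-map : ∀ {A B : Set} (p : B → Bool) (f : A → B) xs → count p (map f xs) ≡ count (p ∘ f) xs
  count-map p f [] = refl
  count-map p f (x ∷ xs) with p (f x)
  ... | true  = cong suc (count-map p f xs)
  ... | false = count-map p f xs

module Hypercube where

  open import Data.Bool using (Bool; true; false; not; _xor_)
  open import Data.Bool.Properties using (xor-comm; not-involutive; not-distribˡ-xor; not-distribʳ-xor; xor-annihilates-not; not-¬)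
  open import Data.Nat using (ℕ; zero; suc; _≤ᵇ_; _≡ᵇ_)
  open import Data.Vec using (Vec; []; _∷_)
  open import Data.List using (map)
  open import Data.List.Relation.Unary.Any using (here)
  import Data.List.Relation.Unary.Any.Properties as Any
  open import Data.List.Membership.Propositional using (_∈_)
  open import Data.List.Membership.Propositional.Properties using (∈-map⁺)
  open import Data.Sum using (_⊎_; inj₁; inj₂)
  open import Data.Empty using (⊥-elim)
  open import Function using (case_of_)
  open import Relation.Nullary using (¬_)
  open import Relation.Binary.PropositionalEquality

  Vertex : ℕ → Set
  Vertex n = Vec Bool n

  ∈-vertices : ∀ {n} (x : Vertex n) → x ∈ vertices n
  ∈-vertices [] = here refl
  ∈-vertices {suc n} (false ∷ x) = Any.++⁺ˡ (∈-map⁺ (false ∷_) (∈-vertices x))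
  ∈-vertices {suc n} (true ∷ x) = Any.++⁺ʳ (map (false ∷_) (vertices n)) (∈-map⁺ (true ∷_) (∈-vertices x))

  hamming-comm : ∀ {n} (u v : Vertex n) → hamming u v ≡ hamming v u
  hamming-comm [] [] = refl
  hamming-comm (a ∷ u) (b ∷ v) rewrite xor-comm a b | hamming-comm u v = refl

  hamming-self : ∀ {n} (u : Vertex n) → hamming u u ≡ 0
  hamming-self [] = refl
  hamming-self (false ∷ u) = hamming-self u
  hamming-self (true ∷ u) = hamming-self u

  hamming≡0⇒≡ : ∀ {n} (u v : Vertex n) → hamming u v ≡ 0 → u ≡ v
  hamming≡0⇒≡ [] [] _ = refl
  hamming≡0⇒≡ (false ∷ u) (false ∷ v) h≡0 = cong (false ∷_) (hamming≡0⇒≡ u v h≡0)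
  hamming≡0⇒≡ (true ∷ u) (true ∷ v) h≡0 = cong (true ∷_) (hamming≡0⇒≡ u v h≡0)

  isOdd : ℕ → Bool
  isOdd zero = false
  isOdd (suc n) = not (isOdd n)

  isOdd-hamming : ∀ {n} (u v : Vertex n) → isOdd (hamming u v) ≡ black u xor black v
  isOdd-hamming [] [] = refl
  isOdd-hamming (false ∷ u) (false ∷ v) = isOdd-hamming u v
  isOdd-hamming (false ∷ u) (true ∷ v) = trans (cong not (isOdd-hamming u v)) (not-distribʳ-xor (black u) (black v))
  isOdd-hamming (true ∷ u) (false ∷ v) = trans (cong not (isOdd-hamming u v)) (not-distribˡ-xor (black u) (black v))
  isOdd-hamming (true ∷ u) (true ∷ v) = trans (isOdd-hamming u v) (sym (xor-annihilates-not (black u) (black v)))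

  ≡ᵇ1⇒≡1 : ∀ m → (m ≡ᵇ 1) ≡ true → m ≡ 1
  ≡ᵇ1⇒≡1 (suc zero) _ = refl

  record _∼_ {n} (u v : Vertex n) : Set where
    constructor adj
    field isAdjacent : adjacent u v ≡ true
  open _∼_ public

  record _∈N[_] {n} (u v : Vertex n) : Set where
    constructor nbhd
    field isNear : inClosedNbhd v u ≡ true
  open _∈N[_] public

  ∼-sym : ∀ {n} {u v : Vertex n} → u ∼ v → v ∼ u
  ∼-sym {u = u} {v} (adj u∼v) = adj (subst (λ m → (m ≡ᵇ 1) ≡ true) (hamming-comm u v) u∼v)

  black-∼ : ∀ {n} {u v : Vertex n} → u ∼ v → black u ≡ not (black v)
  black-∼ {u = u} {v} (adj u∼v) =
    flip (black u) (black v) (trans (cong isOdd (sym (≡ᵇ1⇒≡1 (hamming u v) u∼v))) (isOdd-hamming u v))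
    where
    flip : ∀ a b → true ≡ a xor b → a ≡ not b
    flip false true _ = refl
    flip true false _ = refl

  ∈N-refl : ∀ {n} (v : Vertex n) → v ∈N[ v ]
  ∈N-refl v = nbhd (cong (_≤ᵇ 1) (hamming-self v))

  ∼⇒∈N : ∀ {n} {u v : Vertex n} → u ∼ v → u ∈N[ v ]
  ∼⇒∈N {u = u} {v} (adj u∼v) = nbhd (cong (_≤ᵇ 1) (≡ᵇ1⇒≡1 (hamming u v) u∼v))

  ∈N⇒≡⊎∼ : ∀ {n} {u v : Vertex n} → u ∈N[ v ] → u ≡ v ⊎ u ∼ v
  ∈N⇒≡⊎∼ {u = u} {v} (nbhd u∈Nv) with hamming u v in h
  ... | zero = inj₁ (hamming≡0⇒≡ u v h)
  ... | suc zero = inj₂ (adj (cong (_≡ᵇ 1) h))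

  ∈N-colour⇒≡ : ∀ {n} {u v : Vertex n} → u ∈N[ v ] → black u ≡ black v → u ≡ v
  ∈N-colour⇒≡ u∈Nv bu≡bv with ∈N⇒≡⊎∼ u∈Nv
  ... | inj₁ u≡v = u≡v
  ... | inj₂ u∼v with () ← not-¬ bu≡bv (black-∼ u∼v)

  ∈N? : ∀ {n} (x v : Vertex n) → x ∈N[ v ] ⊎ ¬ x ∈N[ v ]
  ∈N? x v with inClosedNbhd v x in near
  ... | true  = inj₁ (nbhd near)
  ... | false = inj₂ λ { (nbhd near′) → case trans (sym near) near′ of λ () }

  black-∼∈N : ∀ {n} {y z u : Vertex n} → y ∼ z → z ∈N[ u ] → ¬ y ∈N[ u ] → black y ≡ black u
  black-∼∈N y∼z z∈Nu y∉Nu with ∈N⇒≡⊎∼ z∈Nu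
  ... | inj₁ refl = ⊥-elim (y∉Nu (∼⇒∈N y∼z))
  ... | inj₂ z∼u = trans (black-∼ y∼z) (trans (cong not (black-∼ z∼u)) (not-involutive _))

module Positions where

  open Counting
  open Hypercube
  open import Data.Bool using (Bool; true; false; not; _∧_; _∨_)
  open import Data.Bool.Properties using (∧-conicalˡ; ∧-conicalʳ; ¬-not; not-¬; not-injective)
  open import Data.Bool.ListAction using (any)
  open import Data.Nat using (ℕ; suc; _+_; _≤_; _<_)
  import Data.Nat.Properties as ℕ
  open import Data.Vec using (_∷_)
  open import Data.List using (List; filterᵇ; length)
  open import Data.Product using (_×_; _,_; ∃; proj₂)
  open import Data.Empty using (⊥-elim)
  open import Relation.Nullary using (¬_)
  open import Relation.Binary.PropositionalEquality

  module _ {n : ℕ} where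

    -- A position is the vertex set of an induced subgraph of H_n, as a characteristic function;
    -- play v P is Defs.after on it (after-listOf).
    Position : Set
    Position = Vertex n → Bool

    listOf : Position → List (Vertex n)
    listOf P = filterᵇ P (vertices n)

    size : Position → ℕ
    size P = count P (vertices n)

    delete : Vertex n → Position → Position
    delete v P u = P u ∧ not (inClosedNbhd v u)

    dropIsolated : Position → Position
    dropIsolated P u = P u ∧ any (adjacent u) (listOf P)

    play : Vertex n → Position → Position
    play v P = dropIsolated (delete v P)

    -- A record, so that P can be inferred from a membership proof.
    record _∈ₚ_ (u : Vertex n) (P : Position) : Set where
      constructor ⟨_⟩
      field holds : P u ≡ true
    open _∈ₚ_ public

    _⊆ₚ_ : Position → Position → Set
    P ⊆ₚ Q = ∀ u → u ∈ₚ P → u ∈ₚ Q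

    IsolateFree : Position → Set
    IsolateFree P = ∀ x → x ∈ₚ P → ∃ λ y → y ∈ₚ P × x ∼ y

    after-listOf : ∀ v P → after v (listOf P) ≡ listOf (play v P)
    after-listOf v P =
      trans (cong (λ S → filterᵇ (λ u → any (adjacent u) S) S) (filterᵇ-filterᵇ P (λ u → not (inClosedNbhd v u)) (vertices n)))
            (filterᵇ-filterᵇ (delete v P) (λ u → any (adjacent u) (listOf (delete v P))) (vertices n))

    listOf-cong : ∀ {P Q} → P ≗ Q → listOf P ≡ listOf Q
    listOf-cong = filterᵇ-cong (vertices n)

    size-cong : ∀ {P Q} → P ≗ Q → size P ≡ size Q
    size-cong P≗Q = cong length (listOf-cong P≗Q)

    ⊆ₚ-antisym : ∀ {P Q} → P ⊆ₚ Q → Q ⊆ₚ P → P ≗ Q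
    ⊆ₚ-antisym {P} {Q} P⊆Q Q⊆P u with P u in Pu | Q u in Qu
    ... | true  | true  = refl
    ... | false | false = refl
    ... | true  | false = trans (sym (holds (P⊆Q u ⟨ Pu ⟩))) Qu
    ... | false | true  = trans (sym Pu) (holds (Q⊆P u ⟨ Qu ⟩))

    ≗⇒⊆ₚ : ∀ {P Q} → P ≗ Q → P ⊆ₚ Q
    ≗⇒⊆ₚ P≗Q u ⟨ Pu ⟩ = ⟨ trans (sym (P≗Q u)) Pu ⟩

    size-mono : ∀ {P Q} → P ⊆ₚ Q → size P ≤ size Q
    size-mono {P} {Q} P⊆Q = count-mono P Q (vertices n) (λ x Px → holds (P⊆Q x ⟨ Px ⟩))

    dropIsolated⁺ : ∀ {P u x} → u ∈ₚ P → x ∈ₚ P → u ∼ x → u ∈ₚ dropIsolated P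
    dropIsolated⁺ {P} {u} ⟨ Pu ⟩ ⟨ Px ⟩ u∼x =
      ⟨ cong₂ _∧_ Pu (any⁺ (adjacent u) (∈-filterᵇ⁺ P (∈-vertices _) Px) (isAdjacent u∼x)) ⟩

    dropIsolated⁻ : ∀ {P u} → u ∈ₚ dropIsolated P → u ∈ₚ P
    dropIsolated⁻ {P} {u} ⟨ h ⟩ = ⟨ ∧-conicalˡ (P u) _ h ⟩

    dropIsolated-neighbour : ∀ {P u} → u ∈ₚ dropIsolated P → ∃ λ x → x ∈ₚ P × u ∼ x
    dropIsolated-neighbour {P} {u} ⟨ h ⟩ with any⁻ (adjacent u) (listOf P) (∧-conicalʳ (P u) _ h)
    ... | x , x∈P , u∼x = x , ⟨ proj₂ (∈-filterᵇ⁻ P (vertices n) x∈P) ⟩ , adj u∼x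

    dropIsolated-isolateFree : ∀ P → IsolateFree (dropIsolated P)
    dropIsolated-isolateFree P x x∈P′ with dropIsolated-neighbour x∈P′
    ... | y , y∈P , x∼y = y , dropIsolated⁺ y∈P (dropIsolated⁻ x∈P′) (∼-sym x∼y) , x∼y

    dropIsolated-cong : ∀ {P Q} → P ≗ Q → dropIsolated P ≗ dropIsolated Q
    dropIsolated-cong {P} {Q} P≗Q u rewrite P≗Q u | listOf-cong P≗Q = refl

    delete⁺ : ∀ {v P u} → u ∈ₚ P → ¬ u ∈N[ v ] → u ∈ₚ delete v P
    delete⁺ ⟨ Pu ⟩ u∉Nv = ⟨ cong₂ _∧_ Pu (cong not (¬-not (λ near → u∉Nv (nbhd near)))) ⟩

    delete⁻ : ∀ {v P u} → u ∈ₚ delete v P → u ∈ₚ P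
    delete⁻ {v} {P} {u} ⟨ h ⟩ = ⟨ ∧-conicalˡ (P u) _ h ⟩

    delete-far : ∀ {v P u} → u ∈ₚ delete v P → ¬ u ∈N[ v ]
    delete-far {v} {P} {u} ⟨ h ⟩ (nbhd near) with () ← trans (sym (cong not near)) (∧-conicalʳ (P u) _ h)

    delete-cong : ∀ {P Q} v → P ≗ Q → delete v P ≗ delete v Q
    delete-cong v P≗Q u rewrite P≗Q u = refl

    delete-comm : ∀ a b P → delete a (delete b P) ≗ delete b (delete a P)
    delete-comm a b P = ⊆ₚ-antisym swap swap
      where
      swap : ∀ {a b} → delete a (delete b P) ⊆ₚ delete b (delete a P)
      swap u u∈P′ = delete⁺ (delete⁺ (delete⁻ (delete⁻ u∈P′)) (delete-far u∈P′)) (delete-far (delete⁻ u∈P′))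

    play-cong : ∀ {P Q} v → P ≗ Q → play v P ≗ play v Q
    play-cong v P≗Q = dropIsolated-cong (delete-cong v P≗Q)

    play⁻ : ∀ {v P u} → u ∈ₚ play v P → u ∈ₚ P
    play⁻ u∈P′ = delete⁻ (dropIsolated⁻ u∈P′)

    play-far : ∀ {v P u} → u ∈ₚ play v P → ¬ u ∈N[ v ]
    play-far u∈P′ = delete-far (dropIsolated⁻ u∈P′)

    size-play≤size : ∀ v P → size (play v P) ≤ size P
    size-play≤size v P = size-mono (λ u → play⁻ {v = v})

    size-play< : ∀ {v P} → v ∈ₚ P → size (play v P) < size P
    size-play< {v} {P} ⟨ Pv ⟩ = count-mono-< P (play v P) (vertices n)
      (λ x h → holds (play⁻ {v} ⟨ h ⟩)) (∈-vertices v) Pv v∉P′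
      where
      v∉P′ : play v P v ≡ false
      v∉P′ with play v P v in h
      ... | false = refl
      ... | true with () ← play-far ⟨ h ⟩ (∈N-refl v)

    -- Deleting only removes vertices, so isolated vertices dropped earlier would be dropped again anyway.
    dropIsolated-delete-dropIsolated : ∀ v Q → dropIsolated (delete v (dropIsolated Q)) ≗ dropIsolated (delete v Q)
    dropIsolated-delete-dropIsolated v Q = ⊆ₚ-antisym ⊆ ⊇
      where
      ⊆ : dropIsolated (delete v (dropIsolated Q)) ⊆ₚ dropIsolated (delete v Q)
      ⊆ x x∈ with dropIsolated-neighbour x∈
      ... | z , z∈ , x∼z =
        dropIsolated⁺ (delete⁺ (dropIsolated⁻ (delete⁻ (dropIsolated⁻ x∈))) (delete-far (dropIsolated⁻ x∈)))
                      (delete⁺ (dropIsolated⁻ (delete⁻ z∈)) (delete-far z∈)) x∼z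
      ⊇ : dropIsolated (delete v Q) ⊆ₚ dropIsolated (delete v (dropIsolated Q))
      ⊇ x x∈ with dropIsolated-neighbour x∈
      ... | z , z∈ , x∼z =
        dropIsolated⁺ (delete⁺ (dropIsolated⁺ (delete⁻ (dropIsolated⁻ x∈)) (delete⁻ z∈) x∼z) (delete-far (dropIsolated⁻ x∈)))
                      (delete⁺ (dropIsolated⁺ (delete⁻ z∈) (delete⁻ (dropIsolated⁻ x∈)) (∼-sym x∼z)) (delete-far z∈)) x∼z

    play-play : ∀ a b P → play a (play b P) ≗ dropIsolated (delete a (delete b P))
    play-play a b P = dropIsolated-delete-dropIsolated a (delete b P)

    play-comm : ∀ a b P → play a (play b P) ≗ play b (play a P)
    play-comm a b P u = trans (play-play a b P u)
      (trans (dropIsolated-cong (delete-comm a b P) u) (sym (play-play b a P u)))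

    play-rotate : ∀ a b c P → play a (play b (play c P)) ≗ play b (play c (play a P))
    play-rotate a b c P u = trans (play-comm a b (play c P) u) (play-cong b (play-comm a c P) u)

    play-far-from : ∀ {u Q} → IsolateFree Q → (∀ x → x ∈ₚ Q → ¬ x ∈N[ u ]) → play u Q ≗ Q
    play-far-from {u} {Q} isolateFree far = ⊆ₚ-antisym (λ x → play⁻ {v = u}) keep
      where
      keep : Q ⊆ₚ play u Q
      keep x x∈Q with y , y∈Q , x∼y ← isolateFree x x∈Q =
        dropIsolated⁺ (delete⁺ x∈Q (far x x∈Q)) (delete⁺ y∈Q (far y y∈Q)) x∼y

    -- After the move of its own colour x keeps a neighbour z; z has the colour of the other move, so it
    -- is near that move only if it is the played vertex itself, which x avoids.
    ∈-play-play : ∀ {b w P x} → black b ≡ true → black w ≡ false →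
                  x ∈ₚ play b P → x ∈ₚ play w P → x ∈ₚ play b (play w P)
    ∈-play-play {b} {w} {P} {x} bb bw x∈Pb x∈Pw with black x in bx
    ... | true with dropIsolated-neighbour x∈Pb
    ...   | z , z∈ , x∼z = dropIsolated⁺ (delete⁺ x∈Pw (play-far x∈Pb)) (delete⁺ z∈Pw (delete-far z∈)) x∼z
      where
      z∉Nw : ¬ z ∈N[ w ]
      z∉Nw z∈Nw with ∈N-colour⇒≡ z∈Nw (trans (black-∼ (∼-sym x∼z)) (trans (cong not bx) (sym bw)))
      ... | refl = play-far x∈Pw (∼⇒∈N x∼z)
      z∈Pw : z ∈ₚ play w P
      z∈Pw = dropIsolated⁺ (delete⁺ (delete⁻ z∈) z∉Nw) (delete⁺ (play⁻ x∈Pb) (play-far x∈Pw)) (∼-sym x∼z)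
    ∈-play-play {b} {w} {P} {x} bb bw x∈Pb x∈Pw | false with dropIsolated-neighbour x∈Pw
    ...   | y , y∈ , x∼y = dropIsolated⁺ (delete⁺ x∈Pw (play-far x∈Pb)) (delete⁺ y∈Pw y∉Nb) x∼y
      where
      y∉Nb : ¬ y ∈N[ b ]
      y∉Nb y∈Nb with ∈N-colour⇒≡ y∈Nb (trans (black-∼ (∼-sym x∼y)) (trans (cong not bx) (sym bb)))
      ... | refl = play-far x∈Pb (∼⇒∈N x∼y)
      y∈Pw : y ∈ₚ play w P
      y∈Pw = dropIsolated⁺ y∈ (delete⁺ (play⁻ x∈Pw) (play-far x∈Pw)) (∼-sym x∼y)

    size≡0 : ∀ {P} → (∀ x → ¬ x ∈ₚ P) → size P ≡ 0
    size≡0 {P} empty = ℕ.n≤0⇒n≡0 (ℕ.≤-trans (count-mono P (λ _ → false) (vertices n) (λ x Px → ⊥-elim (empty x ⟨ Px ⟩)))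
                                            (ℕ.≤-reflexive (count-false (vertices n))))

    dropIsolated-monochromatic : ∀ {R} c → (∀ v → v ∈ₚ dropIsolated R → black v ≡ c) → size (dropIsolated R) ≡ 0
    dropIsolated-monochromatic {R} c mono = size≡0 λ x x∈ → contradiction x x∈
      where
      contradiction : ∀ x → ¬ x ∈ₚ dropIsolated R
      contradiction x x∈ with y , y∈ , x∼y ← dropIsolated-isolateFree R x x∈ =
        not-¬ (trans (mono x x∈) (sym (mono y y∈))) (black-∼ x∼y)

    size-supermodular : ∀ {b w} P → black b ≡ true → black w ≡ false →
                        size (play w P) + size (play b P) ≤ size P + size (play b (play w P))
    size-supermodular {b} {w} P bb bw = begin
      size (play w P) + size (play b P)                      ≡⟨ count-∨-∧ (play w P) (play b P) (vertices n) ⟩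
      count (λ x → play w P x ∨ play b P x) (vertices n) +
      count (λ x → play w P x ∧ play b P x) (vertices n)     ≤⟨ ℕ.+-mono-≤ (count-mono _ P (vertices n) ∪⊆P)
                                                                            (count-mono _ _ (vertices n) ∩⊆Pwb) ⟩
      size P + size (play b (play w P))                      ∎
      where
      open ℕ.≤-Reasoning
      ∪⊆P : ∀ x → (play w P x ∨ play b P x) ≡ true → P x ≡ true
      ∪⊆P x h with play w P x in x∈Pw
      ... | true = holds (play⁻ {v = w} ⟨ x∈Pw ⟩)
      ... | false = holds (play⁻ {v = b} ⟨ h ⟩)
      ∩⊆Pwb : ∀ x → (play w P x ∧ play b P x) ≡ true → play b (play w P) x ≡ true
      ∩⊆Pwb x h = holds (∈-play-play bb bw ⟨ ∧-conicalʳ (play w P x) _ h ⟩ ⟨ ∧-conicalˡ (play w P x) _ h ⟩)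

    removedBy : Vertex n → Position → Position
    removedBy v P y = P y ∧ not (play v P y)

    removedBy⁺ : ∀ {v P y} → y ∈ₚ P → ¬ y ∈ₚ play v P → y ∈ₚ removedBy v P
    removedBy⁺ ⟨ Py ⟩ y∉P′ = ⟨ cong₂ _∧_ Py (cong not (¬-not (λ h → y∉P′ ⟨ h ⟩))) ⟩

    removedBy⁻ : ∀ {v P y} → y ∈ₚ removedBy v P → y ∈ₚ P × ¬ y ∈ₚ play v P
    removedBy⁻ {v} {P} {y} ⟨ h ⟩ =
      ⟨ ∧-conicalˡ (P y) _ h ⟩ , λ y∈P′ → not-¬ (holds y∈P′) (not-injective {y = false} (∧-conicalʳ (P y) _ h))

  whole-isolateFree : ∀ {k} → IsolateFree {suc k} (λ _ → true)
  whole-isolateFree (a ∷ x) _ = not a ∷ x , ⟨ refl ⟩ , adj (flip a)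
    where
    flip : ∀ a → adjacent (a ∷ x) (not a ∷ x) ≡ true
    flip false rewrite hamming-self x = refl
    flip true rewrite hamming-self x = refl

module ScoringGames where

  open import Data.Integer using (ℤ; +_; _+_; _⊔_; _⊓_; _≤_)
  open import Data.Integer.Properties
  open import Data.List using (List; []; _∷_; _++_; map)
  open import Data.List.Relation.Unary.All using (All; []; _∷_; tabulate; lookup)
  import Data.List.Relation.Unary.All.Properties as AllP
  open import Data.List.Relation.Unary.Any using (Any; here; there)
  import Data.List.Relation.Unary.Any.Properties as Any
  open import Data.List.Properties using (++-conicalʳ)
  open import Data.List.Membership.Propositional using (_∈_)
  open import Data.Product using (_×_; _,_; proj₂; ∃₂)
  open import Data.Sum using (_⊎_; inj₁; inj₂)
  open import Relation.Binary.PropositionalEquality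
  open ≤-Reasoning

  Option : Set
  Option = ℤ × Game

  leftOptions rightOptions : Game → List Option
  leftOptions  (mk L R) = L
  rightOptions (mk L R) = R

  𝟘 : Game
  𝟘 = mk [] []

  leftValue rightValue : Option → ℤ
  leftValue  (d , g) = d + Rs g
  rightValue (d , g) = d + Ls g

  seed≤maxOpt : ∀ a L → a ≤ maxOpt a L
  seed≤maxOpt a [] = ≤-refl
  seed≤maxOpt a ((d , g) ∷ L) = ≤-trans (i≤i⊔j a _) (seed≤maxOpt _ L)

  option≤maxOpt : ∀ a L {o} → o ∈ L → leftValue o ≤ maxOpt a L
  option≤maxOpt a ((d , g) ∷ L) (here refl) = ≤-trans (i≤j⊔i a _) (seed≤maxOpt _ L)
  option≤maxOpt a ((d , g) ∷ L) (there o∈L) = option≤maxOpt _ L o∈L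

  maxOpt≤ : ∀ a L {c} → a ≤ c → All (λ o → leftValue o ≤ c) L → maxOpt a L ≤ c
  maxOpt≤ a [] a≤c [] = a≤c
  maxOpt≤ a ((d , g) ∷ L) a≤c (o≤c ∷ L≤c) = maxOpt≤ _ L (⊔-lub a≤c o≤c) L≤c

  maxOpt-attained : ∀ a L → maxOpt a L ≡ a ⊎ Any (λ o → maxOpt a L ≡ leftValue o) L
  maxOpt-attained a [] = inj₁ refl
  maxOpt-attained a ((d , g) ∷ L) with maxOpt-attained (a ⊔ (d + Rs g)) L
  ... | inj₂ o = inj₂ (there o)
  ... | inj₁ e with ⊔-sel a (d + Rs g)
  ...   | inj₁ e′ = inj₁ (trans e e′)
  ...   | inj₂ e′ = inj₂ (here (trans e e′))

  minOpt≤seed : ∀ a R → minOpt a R ≤ a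
  minOpt≤seed a [] = ≤-refl
  minOpt≤seed a ((d , g) ∷ R) = ≤-trans (minOpt≤seed _ R) (i⊓j≤i a _)

  minOpt≤option : ∀ a R {o} → o ∈ R → minOpt a R ≤ rightValue o
  minOpt≤option a ((d , g) ∷ R) (here refl) = ≤-trans (minOpt≤seed _ R) (i⊓j≤j a _)
  minOpt≤option a ((d , g) ∷ R) (there o∈R) = minOpt≤option _ R o∈R

  ≤minOpt : ∀ a R {c} → c ≤ a → All (λ o → c ≤ rightValue o) R → c ≤ minOpt a R
  ≤minOpt a [] c≤a [] = c≤a
  ≤minOpt a ((d , g) ∷ R) c≤a (c≤o ∷ c≤R) = ≤minOpt _ R (⊓-glb c≤a c≤o) c≤R

  option≤Ls : ∀ G {o} → o ∈ leftOptions G → leftValue o ≤ Ls G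
  option≤Ls (mk ((d , g) ∷ L) R) (here refl) = seed≤maxOpt _ L
  option≤Ls (mk ((d , g) ∷ L) R) (there o∈L) = option≤maxOpt _ L o∈L

  Ls≤ : ∀ L R {c} → All (λ o → leftValue o ≤ c) L → (L ≡ [] → + 0 ≤ c) → Ls (mk L R) ≤ c
  Ls≤ [] R [] nil = nil refl
  Ls≤ ((d , g) ∷ L) R (o≤c ∷ L≤c) nil = maxOpt≤ _ L o≤c L≤c

  Ls-attained : ∀ L R → (L ≡ [] × Ls (mk L R) ≡ + 0) ⊎ Any (λ o → Ls (mk L R) ≡ leftValue o) L
  Ls-attained [] R = inj₁ (refl , refl)
  Ls-attained ((d , g) ∷ L) R with maxOpt-attained (d + Rs g) L
  ... | inj₁ e = inj₂ (here e)
  ... | inj₂ o = inj₂ (there o)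

  Rs≤option : ∀ G {o} → o ∈ rightOptions G → Rs G ≤ rightValue o
  Rs≤option (mk L ((d , g) ∷ R)) (here refl) = minOpt≤seed _ R
  Rs≤option (mk L ((d , g) ∷ R)) (there o∈R) = minOpt≤option _ R o∈R

  ≤Rs : ∀ L R {c} → All (λ o → c ≤ rightValue o) R → (R ≡ [] → c ≤ + 0) → c ≤ Rs (mk L R)
  ≤Rs L [] [] nil = nil refl
  ≤Rs L ((d , g) ∷ R) (c≤o ∷ c≤R) nil = ≤minOpt _ R c≤o c≤R

  Ls-map-cong : ∀ {A : Set} (xs : List A) (f g : A → Option) R R′ → (∀ {x} → x ∈ xs → leftValue (f x) ≡ leftValue (g x)) →
                Ls (mk (map f xs) R) ≡ Ls (mk (map g xs) R′)
  Ls-map-cong [] f g R R′ f≗g = refl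
  Ls-map-cong (x ∷ xs) f g R R′ f≗g rewrite f≗g (here refl) = maxOpt-map-cong _ xs (λ x∈xs → f≗g (there x∈xs))
    where
    maxOpt-map-cong : ∀ a xs → (∀ {x} → x ∈ xs → leftValue (f x) ≡ leftValue (g x)) →
                      maxOpt a (map f xs) ≡ maxOpt a (map g xs)
    maxOpt-map-cong a [] f≗g = refl
    maxOpt-map-cong a (y ∷ ys) f≗g rewrite f≗g (here refl) = maxOpt-map-cong _ ys (λ y∈ys → f≗g (there y∈ys))

  Rs-map-cong : ∀ {A : Set} (xs : List A) (f g : A → Option) L L′ → (∀ {x} → x ∈ xs → rightValue (f x) ≡ rightValue (g x)) →
                Rs (mk L (map f xs)) ≡ Rs (mk L′ (map g xs))
  Rs-map-cong [] f g L L′ f≗g = refl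
  Rs-map-cong (x ∷ xs) f g L L′ f≗g rewrite f≗g (here refl) = minOpt-map-cong _ xs (λ x∈xs → f≗g (there x∈xs))
    where
    minOpt-map-cong : ∀ a xs → (∀ {x} → x ∈ xs → rightValue (f x) ≡ rightValue (g x)) →
                      minOpt a (map f xs) ≡ minOpt a (map g xs)
    minOpt-map-cong a [] f≗g = refl
    minOpt-map-cong a (y ∷ ys) f≗g rewrite f≗g (here refl) = minOpt-map-cong _ ys (λ y∈ys → f≗g (there y∈ys))

  leftComp∈ : ∀ {L e g} X → (e , g) ∈ L → (e , g ⊕ X) ∈ leftComp L X
  leftComp∈ X (here refl) = here refl
  leftComp∈ X (there e,g∈L) = there (leftComp∈ X e,g∈L)

  rightComp∈ : ∀ {L e x} G → (e , x) ∈ L → (e , G ⊕ x) ∈ rightComp G L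
  rightComp∈ G (here refl) = here refl
  rightComp∈ G (there e,x∈L) = there (rightComp∈ G e,x∈L)

  All-leftComp : ∀ {P : Option → Set} L X → (∀ {d g} → (d , g) ∈ L → P (d , g ⊕ X)) → All P (leftComp L X)
  All-leftComp [] X f = []
  All-leftComp ((d , g) ∷ L) X f = f (here refl) ∷ All-leftComp L X (λ o∈L → f (there o∈L))

  All-rightComp : ∀ {P : Option → Set} G L → (∀ {d x} → (d , x) ∈ L → P (d , G ⊕ x)) → All P (rightComp G L)
  All-rightComp G [] f = []
  All-rightComp G ((d , x) ∷ L) f = f (here refl) ∷ All-rightComp G L (λ o∈L → f (there o∈L))

  rightComp≡[] : ∀ {G L} → rightComp G L ≡ [] → L ≡ []
  rightComp≡[] {L = []} _ = refl

  mutual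
    ⊕-identityʳ : ∀ G → G ⊕ 𝟘 ≡ G
    ⊕-identityʳ (mk L R) = cong₂ mk (leftComp-𝟘 L) (leftComp-𝟘 R)

    leftComp-𝟘 : ∀ L → leftComp L 𝟘 ++ [] ≡ L
    leftComp-𝟘 [] = refl
    leftComp-𝟘 ((d , g) ∷ L) = cong₂ (λ g′ L′ → (d , g′) ∷ L′) (⊕-identityʳ g) (leftComp-𝟘 L)

  data Mirror : Game → Set where
    mirror : ∀ {L R} →
      (∀ {d g} → (d , g) ∈ L → ∃₂ λ e g′ → (e , g′) ∈ rightOptions g × d + e ≡ + 0 × Mirror g′) →
      (∀ {d g} → (d , g) ∈ R → ∃₂ λ e g′ → (e , g′) ∈ leftOptions g × d + e ≡ + 0 × Mirror g′) →
      Rs (mk L R) ≤ Ls (mk L R) → Mirror (mk L R)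

  cancel : ∀ d e x → d + e ≡ + 0 → d + (e + x) ≡ x
  cancel d e x d+e≡0 = trans (sym (+-assoc d e x)) (trans (cong (_+ x) d+e≡0) (+-identityˡ x))

  reply-≤ : ∀ {e g g′} d X → (e , g′) ∈ rightOptions g → d + e ≡ + 0 → d + Rs (g ⊕ X) ≤ Ls (g′ ⊕ X)
  reply-≤ {e} {mk gL gR} {g′} d X@(mk _ _) e,g′∈gR d+e≡0 = begin
    d + Rs (mk gL gR ⊕ X)   ≤⟨ +-monoʳ-≤ d (Rs≤option (mk gL gR ⊕ X) (Any.++⁺ˡ (leftComp∈ X e,g′∈gR))) ⟩
    d + (e + Ls (g′ ⊕ X))   ≡⟨ cancel d e (Ls (g′ ⊕ X)) d+e≡0 ⟩
    Ls (g′ ⊕ X)             ∎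

  reply-≥ : ∀ {e g g′} d X → (e , g′) ∈ leftOptions g → d + e ≡ + 0 → Rs (g′ ⊕ X) ≤ d + Ls (g ⊕ X)
  reply-≥ {e} {mk gL gR} {g′} d X@(mk _ _) e,g′∈gL d+e≡0 = begin
    Rs (g′ ⊕ X)             ≡⟨ cancel d e (Rs (g′ ⊕ X)) d+e≡0 ⟨
    d + (e + Rs (g′ ⊕ X))   ≤⟨ +-monoʳ-≤ d (option≤Ls (mk gL gR ⊕ X) (Any.++⁺ˡ (leftComp∈ X e,g′∈gL))) ⟩
    d + Ls (mk gL gR ⊕ X)   ∎

  mutual
    Ls-⊕-≤ : ∀ {G} X → Mirror G → Dicotic X → Ls (G ⊕ X) ≤ Ls X
    Ls-⊕-≤ {G@(mk GL GR)} X@(mk XL XR) m dX@(dicotic _ dXL _) =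
      Ls≤ _ _ (AllP.++⁺ (All-leftComp GL X (leftMove-answered X m dX)) (All-rightComp G XL moveInX)) empty
      where
      moveInX : ∀ {d x} → (d , x) ∈ XL → d + Rs (G ⊕ x) ≤ Ls X
      moveInX {d} {x} d,x∈XL = ≤-trans (≤-reflexive (cong (_+_ d) (lookup (invisible-leftOptions {G} XL m dXL) d,x∈XL)))
                                  (option≤Ls X d,x∈XL)
      empty : leftComp GL X ++ rightComp G XL ≡ [] → + 0 ≤ Ls X
      empty e = ≤-reflexive (cong (λ L → Ls (mk L XR)) (sym (rightComp≡[] (++-conicalʳ (leftComp GL X) _ e))))

    ≤-Rs-⊕ : ∀ {G} X → Mirror G → Dicotic X → Rs X ≤ Rs (G ⊕ X)
    ≤-Rs-⊕ {G@(mk GL GR)} X@(mk XL XR) m dX@(dicotic _ _ dXR) =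
      ≤Rs _ _ (AllP.++⁺ (All-leftComp GR X (rightMove-answered X m dX)) (All-rightComp G XR moveInX)) empty
      where
      moveInX : ∀ {d x} → (d , x) ∈ XR → Rs X ≤ d + Ls (G ⊕ x)
      moveInX {d} {x} d,x∈XR = ≤-trans (Rs≤option X d,x∈XR)
                                  (≤-reflexive (cong (_+_ d) (sym (lookup (invisible-rightOptions {G} XR m dXR) d,x∈XR))))
      empty : leftComp GR X ++ rightComp G XR ≡ [] → Rs X ≤ + 0
      empty e = ≤-reflexive (cong (λ R → Rs (mk XL R)) (rightComp≡[] (++-conicalʳ (leftComp GR X) _ e)))

    -- For X = 𝟘 the claims read 0 ≤ Ls G and Rs G ≤ 0; they follow from the two inequalities above
    -- because G is nonzugzwang.
    ≤-Ls-⊕ : ∀ {G} X → Mirror G → Dicotic X → Ls X ≤ Ls (G ⊕ X)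
    ≤-Ls-⊕ {G} (mk [] []) m@(mirror _ _ Rs≤Ls) d𝟘 = begin
      + 0          ≤⟨ ≤-Rs-⊕ 𝟘 m d𝟘 ⟩
      Rs (G ⊕ 𝟘)   ≡⟨ cong Rs (⊕-identityʳ G) ⟩
      Rs G         ≤⟨ Rs≤Ls ⟩
      Ls G         ≡⟨ cong Ls (⊕-identityʳ G) ⟨
      Ls (G ⊕ 𝟘)   ∎
    ≤-Ls-⊕ (mk [] (_ ∷ _)) m (dicotic () _ _)
    ≤-Ls-⊕ {G@(mk GL GR)} X@(mk XL@(_ ∷ _) XR) m (dicotic _ dXL _) = Ls≤ XL XR (tabulate bound) λ ()
      where
      bound : ∀ {o} → o ∈ XL → leftValue o ≤ Ls (G ⊕ X)
      bound {d , x} d,x∈XL = begin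
        d + Rs x         ≡⟨ cong (_+_ d) (lookup (invisible-leftOptions {G} XL m dXL) d,x∈XL) ⟨
        d + Rs (G ⊕ x)   ≤⟨ option≤Ls (G ⊕ X) (Any.++⁺ʳ (leftComp GL X) (rightComp∈ G d,x∈XL)) ⟩
        Ls (G ⊕ X)       ∎

    Rs-⊕-≤ : ∀ {G} X → Mirror G → Dicotic X → Rs (G ⊕ X) ≤ Rs X
    Rs-⊕-≤ {G} (mk [] []) m@(mirror _ _ Rs≤Ls) d𝟘 = begin
      Rs (G ⊕ 𝟘)   ≡⟨ cong Rs (⊕-identityʳ G) ⟩
      Rs G         ≤⟨ Rs≤Ls ⟩
      Ls G         ≡⟨ cong Ls (⊕-identityʳ G) ⟨
      Ls (G ⊕ 𝟘)   ≤⟨ Ls-⊕-≤ 𝟘 m d𝟘 ⟩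
      + 0          ∎
    Rs-⊕-≤ (mk (_ ∷ _) []) m (dicotic () _ _)
    Rs-⊕-≤ {G@(mk GL GR)} X@(mk XL XR@(_ ∷ _)) m (dicotic _ _ dXR) = ≤Rs XL XR (tabulate bound) λ ()
      where
      bound : ∀ {o} → o ∈ XR → Rs (G ⊕ X) ≤ rightValue o
      bound {d , x} d,x∈XR = begin
        Rs (G ⊕ X)       ≤⟨ Rs≤option (G ⊕ X) (Any.++⁺ʳ (leftComp GR X) (rightComp∈ G d,x∈XR)) ⟩
        d + Ls (G ⊕ x)   ≡⟨ cong (_+_ d) (lookup (invisible-rightOptions {G} XR m dXR) d,x∈XR) ⟩
        d + Ls x         ∎

    leftMove-answered : ∀ {GL GR} X → Mirror (mk GL GR) → Dicotic X → ∀ {d g} → (d , g) ∈ GL → d + Rs (g ⊕ X) ≤ Ls X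
    leftMove-answered X (mirror replyL _ _) dX {d} {g} d,g∈GL with replyL d,g∈GL
    ... | e , g′ , e,g′∈gR , d+e≡0 , m′ = ≤-trans (reply-≤ {g = g} d X e,g′∈gR d+e≡0) (Ls-⊕-≤ X m′ dX)

    rightMove-answered : ∀ {GL GR} X → Mirror (mk GL GR) → Dicotic X → ∀ {d g} → (d , g) ∈ GR → Rs X ≤ d + Ls (g ⊕ X)
    rightMove-answered X (mirror _ replyR _) dX {d} {g} d,g∈GR with replyR d,g∈GR
    ... | e , g′ , e,g′∈gL , d+e≡0 , m′ = ≤-trans (≤-Rs-⊕ X m′ dX) (reply-≥ {g = g} d X e,g′∈gL d+e≡0)

    invisible-leftOptions : ∀ {G} XL → Mirror G → All (λ (o : Option) → Dicotic (proj₂ o)) XL →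
                            All (λ (o : Option) → Rs (G ⊕ proj₂ o) ≡ Rs (proj₂ o)) XL
    invisible-leftOptions [] m [] = []
    invisible-leftOptions ((d , x) ∷ XL) m (dx ∷ dXL) =
      ≤-antisym (Rs-⊕-≤ x m dx) (≤-Rs-⊕ x m dx) ∷ invisible-leftOptions XL m dXL

    invisible-rightOptions : ∀ {G} XR → Mirror G → All (λ (o : Option) → Dicotic (proj₂ o)) XR →
                             All (λ (o : Option) → Ls (G ⊕ proj₂ o) ≡ Ls (proj₂ o)) XR
    invisible-rightOptions [] m [] = []
    invisible-rightOptions ((d , x) ∷ XR) m (dx ∷ dXR) =
      ≤-antisym (Ls-⊕-≤ x m dx) (≤-Ls-⊕ x m dx) ∷ invisible-rightOptions XR m dXR

  -- X need not be nonzugzwang.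
  mirror⇒IsZero : ∀ {G} → Mirror G → IsZero G
  mirror⇒IsZero m X dX _ = ≤-antisym (Ls-⊕-≤ X m dX) (≤-Ls-⊕ X m dX) , ≤-antisym (Rs-⊕-≤ X m dX) (≤-Rs-⊕ X m dX)

module InfluenceValues where

  open Counting
  open Hypercube
  open Positions
  open ScoringGames
  open import Data.Bool using (true; false; not)
  open import Data.Bool.Properties using (not-injective)
  open import Data.Nat using (ℕ; zero; suc; _∸_; z≤n) renaming (_≤_ to _≤ℕ_; _+_ to _+ℕ_)
  import Data.Nat.Properties as ℕ
  open import Data.Integer using (ℤ; +_; -_; _+_; _-_; _≤_; +≤+)
  open import Data.Integer.Properties
  open import Data.List using (List; []; _∷_; filterᵇ; map)
  open import Data.List.Properties using (map-cong)
  open import Data.List.Relation.Unary.Any using (here)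
  import Data.List.Relation.Unary.Any.Properties as Any
  open import Data.List.Relation.Unary.All using (tabulate)
  import Data.List.Relation.Unary.All.Properties as AllP
  open import Data.List.Membership.Propositional using (_∈_; find)
  open import Data.List.Membership.Propositional.Properties using (∈-map⁺)
  open import Data.Product using (_×_; _,_; ∃; proj₁; proj₂)
  open import Data.Sum using (_⊎_; inj₁; inj₂)
  open import Relation.Binary.PropositionalEquality

  map≡[]⇒≡[] : ∀ {A B : Set} {f : A → B} {xs} → map f xs ≡ [] → xs ≡ []
  map≡[]⇒≡[] {xs = []} _ = refl

  module _ {n : ℕ} where

    game : ℕ → Position {n} → Game
    game k P = influence k (listOf P)

    leftMove rightMove : ℕ → Position {n} → Vertex n → Option
    leftMove  k P v = (+ removed v (listOf P) , game k (play v P))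
    rightMove k P v = (- (+ removed v (listOf P)) , game k (play v P))

    leftMoves rightMoves : ℕ → Position {n} → List Option
    leftMoves  k P = map (leftMove k P) (filterᵇ black (listOf P))
    rightMoves k P = map (rightMove k P) (filterᵇ white (listOf P))

    game-suc : ∀ k P → game (suc k) P ≡ mk (leftMoves k P) (rightMoves k P)
    game-suc k P = cong₂ mk (map-after black) (map-after white)
      where
      map-after : ∀ {d : Vertex n → ℤ} c → map (λ v → d v , influence k (after v (listOf P))) (filterᵇ c (listOf P))
                                         ≡ map (λ v → d v , game k (play v P)) (filterᵇ c (listOf P))
      map-after c = map-cong (λ v → cong (λ S → _ , influence k S) (after-listOf v P)) _

    ∈-listOf⁺ : ∀ {P : Position {n}} {c v} → v ∈ₚ P → c v ≡ true → v ∈ filterᵇ c (listOf P)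
    ∈-listOf⁺ {P} {c} {v} ⟨ Pv ⟩ cv = ∈-filterᵇ⁺ c (∈-filterᵇ⁺ P (∈-vertices v) Pv) cv

    ∈-listOf⁻ : ∀ {P : Position {n}} {c v} → v ∈ filterᵇ c (listOf P) → v ∈ₚ P × c v ≡ true
    ∈-listOf⁻ {P} {c} v∈ with ∈-filterᵇ⁻ c (listOf P) v∈
    ... | v∈P , cv = ⟨ proj₂ (∈-filterᵇ⁻ P (vertices n) v∈P) ⟩ , cv

    leftMove∈ : ∀ {k} {P : Position {n}} {v} → v ∈ₚ P → black v ≡ true → leftMove k P v ∈ leftOptions (game (suc k) P)
    leftMove∈ {k} {P} {v} v∈P bv =
      subst (λ G → leftMove k P v ∈ leftOptions G) (sym (game-suc k P)) (∈-map⁺ (leftMove k P) (∈-listOf⁺ v∈P bv))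

    rightMove∈ : ∀ {k} {P : Position {n}} {v} → v ∈ₚ P → black v ≡ false → rightMove k P v ∈ rightOptions (game (suc k) P)
    rightMove∈ {k} {P} {v} v∈P wv =
      subst (λ G → rightMove k P v ∈ rightOptions G) (sym (game-suc k P)) (∈-map⁺ (rightMove k P) (∈-listOf⁺ v∈P (cong not wv)))

    no-coloured : ∀ {P : Position {n}} c → filterᵇ c (listOf P) ≡ [] → ∀ v → v ∈ₚ P → c v ≡ false
    no-coloured {P} c none v ⟨ Pv ⟩ = filterᵇ≡[]⇒false c (listOf P) none (∈-filterᵇ⁺ P (∈-vertices v) Pv)

    game-empty : ∀ k (P : Position {n}) → size P ≡ 0 → game k P ≡ 𝟘
    game-empty zero P _ = refl
    game-empty (suc k) P size≡0 rewrite count≡0 P (vertices n) size≡0 = refl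

    size-play≤pred : ∀ {k} {P : Position {n}} {v} → size P ≤ℕ suc k → v ∈ₚ P → size (play v P) ≤ℕ k
    size-play≤pred P≤ v∈P = ℕ.≤-pred (ℕ.≤-trans (size-play< v∈P) P≤)

    fuel-irrelevant : ∀ k k′ (P : Position {n}) → size P ≤ℕ k → size P ≤ℕ k′ →
                      Ls (game k P) ≡ Ls (game k′ P) × Rs (game k P) ≡ Rs (game k′ P)
    fuel-irrelevant zero k′ P P≤k _ rewrite game-empty k′ P (ℕ.n≤0⇒n≡0 P≤k) = refl , refl
    fuel-irrelevant (suc k) zero P _ P≤k′ rewrite game-empty (suc k) P (ℕ.n≤0⇒n≡0 P≤k′) = refl , refl
    fuel-irrelevant (suc k) (suc k′) P P≤k P≤k′ rewrite game-suc k P | game-suc k′ P =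
      Ls-map-cong (filterᵇ black (listOf P)) (leftMove k P) (leftMove k′ P) _ _
        (λ {v} v∈ → cong (_+_ (+ removed v (listOf P))) (proj₂ (after-move v∈))) ,
      Rs-map-cong (filterᵇ white (listOf P)) (rightMove k P) (rightMove k′ P) _ _
        (λ {v} v∈ → cong (_+_ (- (+ removed v (listOf P)))) (proj₁ (after-move v∈)))
      where
      after-move : ∀ {c v} → v ∈ filterᵇ c (listOf P) →
                   Ls (game k (play v P)) ≡ Ls (game k′ (play v P)) × Rs (game k (play v P)) ≡ Rs (game k′ (play v P))
      after-move {c} v∈ with v∈P , _ ← ∈-listOf⁻ {c = c} v∈ =
        fuel-irrelevant k k′ _ (size-play≤pred P≤k v∈P) (size-play≤pred P≤k′ v∈P)

    valueL valueR : Position {n} → ℤ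
    valueL P = Ls (game (size P) P)
    valueR P = Rs (game (size P) P)

    Ls-game : ∀ k P → size P ≤ℕ k → Ls (game k P) ≡ valueL P
    Ls-game k P P≤k = proj₁ (fuel-irrelevant k (size P) P P≤k ℕ.≤-refl)

    Rs-game : ∀ k P → size P ≤ℕ k → Rs (game k P) ≡ valueR P
    Rs-game k P P≤k = proj₂ (fuel-irrelevant k (size P) P P≤k ℕ.≤-refl)

    valueL-cong : ∀ {P Q : Position {n}} → P ≗ Q → valueL P ≡ valueL Q
    valueL-cong P≗Q rewrite size-cong P≗Q | listOf-cong P≗Q = refl

    values-empty : ∀ {P : Position {n}} → size P ≡ 0 → valueL P ≡ + 0 × valueR P ≡ + 0
    values-empty {P} size≡0 rewrite game-empty (size P) P size≡0 = refl , refl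

    gain : Vertex n → Position {n} → ℤ
    gain v P = + size P - + size (play v P)

    gain≡∸ : ∀ v P → gain v P ≡ + (size P ∸ size (play v P))
    gain≡∸ v P = trans (m-n≡m⊖n (size P) (size (play v P))) (⊖-≥ (size-play≤size v P))

    removed≡gain : ∀ v P → + removed v (listOf P) ≡ gain v P
    removed≡gain v P rewrite after-listOf v P = sym (gain≡∸ v P)

    0≤gain : ∀ v (P : Position {n}) → + 0 ≤ gain v P
    0≤gain v P = ≤-trans (+≤+ z≤n) (≤-reflexive (sym (gain≡∸ v P)))

    gain≡removedBy : ∀ v (P : Position {n}) → gain v P ≡ + count (removedBy v P) (vertices n)
    gain≡removedBy v P = trans (gain≡∸ v P) (cong +_ (begin
      size P ∸ size (play v P)                                          ≡⟨ cong (_∸ size (play v P)) split ⟩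
      size (play v P) +ℕ count (removedBy v P) (vertices n) ∸ size (play v P) ≡⟨ ℕ.m+n∸m≡n (size (play v P)) _ ⟩
      count (removedBy v P) (vertices n)                                 ∎))
      where
      open ≡-Reasoning
      split : size P ≡ size (play v P) +ℕ count (removedBy v P) (vertices n)
      split = count-difference P (play v P) (vertices n) (λ x h → holds (play⁻ {v = v} ⟨ h ⟩))

    leftValue-leftMove : ∀ {k P v} → size P ≤ℕ suc k → v ∈ₚ P → leftValue (leftMove k P v) ≡ gain v P + valueR (play v P)
    leftValue-leftMove {k} {P} {v} P≤ v∈P =
      cong₂ _+_ (removed≡gain v P) (Rs-game k (play v P) (size-play≤pred P≤ v∈P))

    rightValue-rightMove : ∀ {k P v} → size P ≤ℕ suc k → v ∈ₚ P → rightValue (rightMove k P v) ≡ - gain v P + valueL (play v P)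
    rightValue-rightMove {k} {P} {v} P≤ v∈P =
      cong₂ (λ r x → - r + x) (removed≡gain v P) (Ls-game k (play v P) (size-play≤pred P≤ v∈P))

    Ls-game-suc : ∀ P → Ls (game (suc (size P)) P) ≡ valueL P
    Ls-game-suc P = Ls-game (suc (size P)) P (ℕ.n≤1+n _)

    Rs-game-suc : ∀ P → Rs (game (suc (size P)) P) ≡ valueR P
    Rs-game-suc P = Rs-game (suc (size P)) P (ℕ.n≤1+n _)

    valueL-move : ∀ {P v} → black v ≡ true → v ∈ₚ P → gain v P + valueR (play v P) ≤ valueL P
    valueL-move {P} {v} bv v∈P = begin
      gain v P + valueR (play v P)        ≡⟨ leftValue-leftMove (ℕ.n≤1+n _) v∈P ⟨
      leftValue (leftMove (size P) P v)   ≤⟨ option≤Ls (game (suc (size P)) P) (leftMove∈ v∈P bv) ⟩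
      Ls (game (suc (size P)) P)          ≡⟨ Ls-game-suc P ⟩
      valueL P                            ∎
      where open ≤-Reasoning

    valueR-move : ∀ {P v} → black v ≡ false → v ∈ₚ P → valueR P ≤ - gain v P + valueL (play v P)
    valueR-move {P} {v} wv v∈P = begin
      valueR P                              ≡⟨ Rs-game-suc P ⟨
      Rs (game (suc (size P)) P)            ≤⟨ Rs≤option (game (suc (size P)) P) (rightMove∈ v∈P wv) ⟩
      rightValue (rightMove (size P) P v)   ≡⟨ rightValue-rightMove (ℕ.n≤1+n _) v∈P ⟩
      - gain v P + valueL (play v P)        ∎
      where open ≤-Reasoning

    valueL-attained : ∀ P → (∃ λ v → black v ≡ true × v ∈ₚ P × valueL P ≡ gain v P + valueR (play v P)) ⊎
                            ((∀ v → v ∈ₚ P → black v ≡ false) × valueL P ≡ + 0)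
    valueL-attained P with Ls-attained (leftMoves (size P) P) (rightMoves (size P) P)
    ... | inj₁ (none , Ls≡0) =
      inj₂ (no-coloured black (map≡[]⇒≡[] none) , trans (sym (Ls-game-suc P)) (trans (cong Ls (game-suc (size P) P)) Ls≡0))
    ... | inj₂ attained with find (Any.map⁻ attained)
    ...   | v , v∈ , Ls≡ with v∈P , bv ← ∈-listOf⁻ v∈ =
      inj₁ (v , bv , v∈P , trans (sym (Ls-game-suc P))
                                 (trans (cong Ls (game-suc (size P) P)) (trans Ls≡ (leftValue-leftMove (ℕ.n≤1+n _) v∈P))))

    ≤valueR : ∀ {P c} → (∀ v → black v ≡ false → v ∈ₚ P → c ≤ - gain v P + valueL (play v P)) →
              ((∀ v → v ∈ₚ P → black v ≡ true) → c ≤ + 0) → c ≤ valueR P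
    ≤valueR {P} {c} moves allBlack = ≤-trans
      (≤Rs (leftMoves (size P) P) (rightMoves (size P) P) (AllP.map⁺ (tabulate bound)) noMove)
      (≤-reflexive (trans (cong Rs (sym (game-suc (size P) P))) (Rs-game-suc P)))
      where
      bound : ∀ {v} → v ∈ filterᵇ white (listOf P) → c ≤ rightValue (rightMove (size P) P v)
      bound v∈ with v∈P , wv ← ∈-listOf⁻ v∈ =
        ≤-trans (moves _ (not-injective {y = false} wv) v∈P) (≤-reflexive (sym (rightValue-rightMove (ℕ.n≤1+n _) v∈P)))
      noMove : rightMoves (size P) P ≡ [] → c ≤ + 0
      noMove none = allBlack (λ v v∈P → not-injective {y = true} (no-coloured white (map≡[]⇒≡[] none) v v∈P))

    white-or-allBlack : ∀ (P : Position {n}) → (∃ λ u → black u ≡ false × u ∈ₚ P) ⊎ (∀ v → v ∈ₚ P → black v ≡ true)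
    white-or-allBlack P with filterᵇ white (listOf P) in whites
    ... | [] = inj₂ λ v v∈P → not-injective {y = true} (no-coloured white whites v v∈P)
    ... | u ∷ _ with u∈P , wu ← ∈-listOf⁻ {c = white} (subst (u ∈_) (sym whites) (here refl)) =
      inj₁ (u , not-injective {y = false} wu , u∈P)

    valueR-allBlack : ∀ {P : Position {n}} → (∀ v → v ∈ₚ P → black v ≡ true) → valueR P ≡ + 0
    valueR-allBlack {P} allBlack =
      trans (sym (Rs-game-suc P)) (trans (cong Rs (game-suc (size P) P))
            (cong (λ ws → Rs (mk (leftMoves (size P) P) (map (rightMove (size P) P) ws))) noWhite))
      where
      noWhite : filterᵇ white (listOf P) ≡ []
      noWhite = filterᵇ-none white (listOf P) λ v∈ →
        cong not (allBlack _ ⟨ proj₂ (∈-filterᵇ⁻ P (vertices n) v∈) ⟩)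

module InfluenceNonzugzwang where

  open Hypercube
  open Positions
  open InfluenceValues
  open import Data.Bool using (true; false)
  open import Data.Nat using (ℕ; zero; suc) renaming (_≤_ to _≤ℕ_; _+_ to _+ℕ_)
  import Data.Nat.Properties as ℕ
  open import Data.Integer using (ℤ; +_; -_; _+_; _-_; _≤_; +≤+; nonNegative)
  open import Data.Integer.Properties
  open import Data.Integer.Tactic.RingSolver using (solve-∀)
  open import Data.Product using (_×_; _,_; proj₁; proj₂)
  open import Data.Sum using (_⊎_; inj₁; inj₂)
  open import Relation.Nullary using (¬_)
  open import Relation.Binary.PropositionalEquality
  open import Function using (case_of_)

  i+j≤k+l⇒i-l≤k-j : ∀ i j k l → i + j ≤ k + l → i - l ≤ k - j
  i+j≤k+l⇒i-l≤k-j i j k l ij≤kl = begin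
    i - l                 ≡⟨ shift i j l ⟩
    (i + j) + (- j - l)   ≤⟨ +-monoˡ-≤ (- j - l) ij≤kl ⟩
    (k + l) + (- j - l)   ≡⟨ unshift k j l ⟩
    k - j                 ∎
    where
    open ≤-Reasoning
    shift : ∀ i j l → i - l ≡ (i + j) + (- j - l)
    shift = solve-∀
    unshift : ∀ k j l → (k + l) + (- j - l) ≡ k - j
    unshift = solve-∀

  i+j≤k+l⇒j-m≤[k-i]+[l-m] : ∀ i j k l m → i + j ≤ k + l → j - m ≤ (k - i) + (l - m)
  i+j≤k+l⇒j-m≤[k-i]+[l-m] i j k l m ij≤kl = begin
    j - m                 ≡⟨ shift i j m ⟩
    (i + j) + (- i - m)   ≤⟨ +-monoˡ-≤ (- i - m) ij≤kl ⟩
    (k + l) + (- i - m)   ≡⟨ unshift k l i m ⟩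
    (k - i) + (l - m)     ∎
    where
    open ≤-Reasoning
    shift : ∀ i j m → j - m ≡ (i + j) + (- i - m)
    shift = solve-∀
    unshift : ∀ k l i m → (k + l) + (- i - m) ≡ (k - i) + (l - m)
    unshift = solve-∀

  module _ {n : ℕ} where

    size-supermodularℤ : ∀ {b w} (P : Position {n}) → black b ≡ true → black w ≡ false →
                         + size (play w P) + + size (play b P) ≤ + size P + + size (play b (play w P))
    size-supermodularℤ {b} {w} P bb bw = begin
      + size (play w P) + + size (play b P)      ≡⟨ pos-+ (size (play w P)) (size (play b P)) ⟨
      + (size (play w P) +ℕ size (play b P))    ≤⟨ +≤+ (size-supermodular P bb bw) ⟩
      + (size P +ℕ size (play b (play w P)))    ≡⟨ pos-+ (size P) (size (play b (play w P))) ⟩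
      + size P + + size (play b (play w P))      ∎
      where open ≤-Reasoning

    gain-play≤gain : ∀ {b w} (P : Position {n}) → black b ≡ true → black w ≡ false → gain b (play w P) ≤ gain b P
    gain-play≤gain {b} {w} P bb bw =
      i+j≤k+l⇒i-l≤k-j (+ size (play w P)) (+ size (play b P)) (+ size P) (+ size (play b (play w P)))
                      (size-supermodularℤ {b} {w} P bb bw)

    gain-exchange : ∀ {b w u} (P : Position {n}) → black b ≡ true → black w ≡ false →
                    gain u (play b P) + gain w (play u (play b P)) ≤ gain w P + gain u (play b (play w P))
    gain-exchange {b} {w} {u} P bb bw = begin
      gain u Pb + gain w Pbu        ≡⟨ +-minus-telescope (+ size Pb) (+ size Pbu) (+ size Pbuw) ⟩
      + size Pb - + size Pbuw       ≤⟨ i+j≤k+l⇒j-m≤[k-i]+[l-m] (+ size Pw) (+ size Pb) (+ size P) (+ size Pwb) (+ size Pbuw)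
                                                              (size-supermodularℤ {b} {w} P bb bw) ⟩
      gain w P + (+ size Pwb - + size Pbuw)
                                    ≡⟨ cong (λ s → gain w P + (+ size Pwb - + s)) (size-cong (play-rotate w u b P)) ⟩
      gain w P + gain u Pwb         ∎
      where
      open ≤-Reasoning
      Pw Pb Pwb Pbu Pbuw : Position {n}
      Pw = play w P
      Pb = play b P
      Pwb = play b Pw
      Pbu = play u Pb
      Pbuw = play w Pbu

    gain≡0 : ∀ {v} {P : Position {n}} → play v P ≗ P → gain v P ≡ + 0
    gain≡0 {v} {P} unchanged = trans (cong (λ s → + size P - + s) (size-cong unchanged)) (+-inverseʳ (+ size P))

    -- A white u that survives b but not w-then-b has no neighbour x in play b (play w P): u is not
    -- near w (else u = w by colour, and x would have been deleted with it), so x would keep u alive.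
    play-vanished : ∀ {b w u} (P : Position {n}) → u ∈ₚ play b P → black u ≡ false → black w ≡ false →
                    ¬ u ∈ₚ play b (play w P) → play u (play b (play w P)) ≗ play b (play w P)
    play-vanished {b} {w} {u} P u∈Pb wu ww u∉Pwb =
      play-far-from (dropIsolated-isolateFree _) far
      where
      far : ∀ x → x ∈ₚ play b (play w P) → ¬ x ∈N[ u ]
      far x x∈ x∈Nu with ∈N⇒≡⊎∼ x∈Nu
      ... | inj₁ refl = u∉Pwb x∈
      ... | inj₂ x∼u = u∉Pwb (≗⇒⊆ₚ (λ y → sym (play-play b w P y)) u
                         (dropIsolated⁺ (delete⁺ (delete⁺ (play⁻ u∈Pb) u∉Nw) (play-far u∈Pb)) x∈′ (∼-sym x∼u)))
        where
        x∈′ : x ∈ₚ delete b (delete w P)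
        x∈′ = dropIsolated⁻ (≗⇒⊆ₚ (play-play b w P) x x∈)
        u∉Nw : ¬ u ∈N[ w ]
        u∉Nw u∈Nw with ∈N-colour⇒≡ u∈Nw (trans wu (sym ww))
        ... | refl = delete-far (delete⁻ x∈′) (∼⇒∈N x∼u)

    -size≤values : ∀ f (P : Position {n}) → size P ≤ℕ f → - + size P ≤ valueL P × - + size P ≤ valueR P
    -size≤values zero P P≤0 with valueL≡0 , valueR≡0 ← values-empty {P = P} (ℕ.n≤0⇒n≡0 P≤0) =
      ≤-trans neg-≤-pos (≤-reflexive (sym valueL≡0)) , ≤-trans neg-≤-pos (≤-reflexive (sym valueR≡0))
    -size≤values (suc f) P P≤ = left , ≤valueR right (λ _ → neg-≤-pos)
      where
      open ≤-Reasoning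
      left : - + size P ≤ valueL P
      left with valueL-attained P
      ... | inj₂ (_ , valueL≡0) = ≤-trans neg-≤-pos (≤-reflexive (sym valueL≡0))
      ... | inj₁ (b , bb , b∈P , valueL≡) = begin
        - + size P                      ≤⟨ neg-mono-≤ (+≤+ (size-play≤size b P)) ⟩
        - + size (play b P)             ≤⟨ proj₂ (-size≤values f (play b P) (size-play≤pred P≤ b∈P)) ⟩
        valueR (play b P)               ≤⟨ i≤j+i _ (gain b P) {{nonNegative (0≤gain b P)}} ⟩
        gain b P + valueR (play b P)    ≡⟨ valueL≡ ⟨
        valueL P                        ∎
      right : ∀ u → black u ≡ false → u ∈ₚ P → - + size P ≤ - gain u P + valueL (play u P)
      right u _ u∈P = begin
        - + size P                                             ≡⟨ telescope (+ size P) (+ size (play u P)) ⟩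
        - (+ size P - + size (play u P)) + - + size (play u P) ≤⟨ +-monoʳ-≤ (- gain u P) (proj₁ (-size≤values f (play u P) Pu≤f)) ⟩
        - gain u P + valueL (play u P)                         ∎
        where
        Pu≤f : size (play u P) ≤ℕ f
        Pu≤f = size-play≤pred P≤ u∈P
        telescope : ∀ s t → - s ≡ - (s - t) + - t
        telescope = solve-∀

    ValuesOrdered : ℕ → Set
    ValuesOrdered f = ∀ (P : Position {n}) → size P ≤ℕ f → valueR P ≤ valueL P

    RightMoveHarmless : ℕ → Set
    RightMoveHarmless f = ∀ (P : Position {n}) w → size P ≤ℕ f → black w ≡ false →
                          - gain w P + valueL (play w P) ≤ valueL P

    harmless⇒ordered : ∀ {f} → RightMoveHarmless f → ValuesOrdered f
    harmless⇒ordered harmless P P≤ with white-or-allBlack P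
    ... | inj₁ (u , wu , u∈P) = ≤-trans (valueR-move wu u∈P) (harmless P u P≤ wu)
    ... | inj₂ allBlack = ≤-trans (≤-reflexive (valueR-allBlack allBlack)) 0≤valueL
      where
      0≤valueL : + 0 ≤ valueL P
      0≤valueL with valueL-attained P
      ... | inj₂ (_ , valueL≡0) = ≤-reflexive (sym valueL≡0)
      ... | inj₁ (b , _ , _ , valueL≡) = begin
        + 0                             ≤⟨ 0≤gain b P ⟩
        gain b P                        ≡⟨ +-identityʳ (gain b P) ⟨
        gain b P + + 0                  ≡⟨ cong (_+_ (gain b P)) (valueR-allBlack (λ v v∈ → allBlack v (play⁻ v∈))) ⟨
        gain b P + valueR (play b P)    ≡⟨ valueL≡ ⟨
        valueL P                        ∎
        where open ≤-Reasoning

    harmless-zero : RightMoveHarmless 0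
    harmless-zero P w P≤0 _ =
      let valueL≡0 , _ = values-empty {P = P} sizeP≡0
          valueLw≡0 , _ = values-empty {P = play w P} sizePw≡0
      in ≤-reflexive (trans (cong₂ (λ s x → - s + x) (cong₂ (λ s t → + s - + t) sizeP≡0 sizePw≡0) valueLw≡0) (sym valueL≡0))
      where
      sizeP≡0 : size P ≡ 0
      sizeP≡0 = ℕ.n≤0⇒n≡0 P≤0
      sizePw≡0 : size (play w P) ≡ 0
      sizePw≡0 = ℕ.n≤0⇒n≡0 (ℕ.≤-trans (size-play≤size w P) P≤0)

    rightMove-postponed : ∀ {f} → ValuesOrdered f → RightMoveHarmless f → ∀ (P : Position {n}) {b w} →
                          size P ≤ℕ suc f → black b ≡ true → black w ≡ false → b ∈ₚ play w P →
                          - gain w P + valueR (play b (play w P)) ≤ valueR (play b P)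
    rightMove-postponed {f} ordered harmless P {b} {w} P≤ bb ww b∈Pw = ≤valueR whiteReply noWhite
      where
      open ≤-Reasoning
      Pb Pwb : Position {n}
      Pb = play b P
      Pwb = play b (play w P)
      whiteReply : ∀ u → black u ≡ false → u ∈ₚ Pb → - gain w P + valueR Pwb ≤ - gain u Pb + valueL (play u Pb)
      whiteReply u wu u∈Pb = begin
        - gain w P + valueR Pwb                                      ≤⟨ +-monoʳ-≤ (- gain w P) answer ⟩
        - gain w P + (- gain u Pwb + valueL (play u Pwb))            ≡⟨ cong (λ x → - gain w P + (- gain u Pwb + x))
                                                                           (valueL-cong (λ x → sym (play-rotate w u b P x))) ⟩
        - gain w P + (- gain u Pwb + valueL (play w (play u Pb)))    ≡⟨ regroup (gain w P) (gain u Pwb) _ ⟩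
        - (gain w P + gain u Pwb) + valueL (play w (play u Pb))      ≤⟨ +-monoˡ-≤ _ (neg-mono-≤ (gain-exchange {b} {w} {u} P bb ww)) ⟩
        - (gain u Pb + gain w (play u Pb)) + valueL (play w (play u Pb)) ≡⟨ regroup (gain u Pb) (gain w (play u Pb)) _ ⟨
        - gain u Pb + (- gain w (play u Pb) + valueL (play w (play u Pb))) ≤⟨ +-monoʳ-≤ (- gain u Pb) (harmless (play u Pb) w Pbu≤f ww) ⟩
        - gain u Pb + valueL (play u Pb)                             ∎
        where
        Pbu≤f : size (play u Pb) ≤ℕ f
        Pbu≤f = ℕ.≤-trans (size-play≤size u Pb) (size-play≤pred P≤ (play⁻ b∈Pw))
        regroup : ∀ g g′ x → - g + (- g′ + x) ≡ - (g + g′) + x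
        regroup = solve-∀
        answer : valueR Pwb ≤ - gain u Pwb + valueL (play u Pwb)
        answer with Pwb u in u∈Pwb
        ... | true = valueR-move {P = Pwb} {v = u} wu ⟨ u∈Pwb ⟩
        ... | false = begin
          valueR Pwb                          ≤⟨ ordered Pwb (size-play≤pred (ℕ.≤-trans (size-play≤size w P) P≤) b∈Pw) ⟩
          valueL Pwb                          ≡⟨ +-identityˡ (valueL Pwb) ⟨
          + 0 + valueL Pwb                    ≡⟨ cong₂ (λ g x → - g + x) (gain≡0 unchanged) (valueL-cong unchanged) ⟨
          - gain u Pwb + valueL (play u Pwb)  ∎
          where
          unchanged : play u Pwb ≗ Pwb
          unchanged = play-vanished P u∈Pb wu ww λ u∈ → case trans (sym (holds u∈)) u∈Pwb of λ ()
      Pwb⊆Pb : Pwb ⊆ₚ Pb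
      Pwb⊆Pb v v∈ = play⁻ {v = w} (≗⇒⊆ₚ (play-comm b w P) v v∈)
      noWhite : (∀ v → v ∈ₚ Pb → black v ≡ true) → - gain w P + valueR Pwb ≤ + 0
      noWhite allBlack = begin
        - gain w P + valueR Pwb   ≡⟨ cong (_+_ (- gain w P)) (valueR-allBlack λ v v∈ → allBlack v (Pwb⊆Pb v v∈)) ⟩
        - gain w P + + 0          ≡⟨ +-identityʳ _ ⟩
        - gain w P                ≤⟨ neg-mono-≤ (0≤gain w P) ⟩
        + 0                       ∎

    harmless-suc : ∀ {f} → ValuesOrdered f → RightMoveHarmless f → RightMoveHarmless (suc f)
    harmless-suc {f} ordered harmless P w P≤ ww with valueL-attained (play w P)
    ... | inj₂ (noBlack , valueLw≡0) = begin
      - gain w P + valueL (play w P)   ≡⟨ cong₂ (λ g x → - g + x) gain≡size valueLw≡0 ⟩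
      - + size P + + 0                 ≡⟨ +-identityʳ _ ⟩
      - + size P                       ≤⟨ proj₁ (-size≤values (suc f) P P≤) ⟩
      valueL P                         ∎
      where
      open ≤-Reasoning
      gain≡size : gain w P ≡ + size P
      gain≡size = trans (cong (λ s → + size P - + s) (dropIsolated-monochromatic false noBlack)) (+-identityʳ (+ size P))
    ... | inj₁ (b , bb , b∈Pw , valueLw≡) = begin
      - gain w P + valueL (play w P)                           ≡⟨ cong (_+_ (- gain w P)) valueLw≡ ⟩
      - gain w P + (gain b (play w P) + valueR Pwb)            ≤⟨ swap (gain w P) (valueR Pwb) (gain-play≤gain {b} {w} P bb ww) ⟩
      gain b P + (- gain w P + valueR Pwb)                     ≤⟨ +-monoʳ-≤ (gain b P) postponed ⟩
      gain b P + valueR (play b P)                             ≤⟨ valueL-move bb (play⁻ b∈Pw) ⟩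
      valueL P                                                 ∎
      where
      open ≤-Reasoning
      Pwb : Position {n}
      Pwb = play b (play w P)
      postponed : - gain w P + valueR Pwb ≤ valueR (play b P)
      postponed = rightMove-postponed ordered harmless P P≤ bb ww b∈Pw
      swap : ∀ x y {g h} → h ≤ g → - x + (h + y) ≤ g + (- x + y)
      swap x y {g} {h} h≤g = ≤-trans (≤-reflexive (exchange x h y)) (+-monoˡ-≤ (- x + y) h≤g)
        where
        exchange : ∀ x h y → - x + (h + y) ≡ h + (- x + y)
        exchange = solve-∀

    rightMoveHarmless : ∀ f → RightMoveHarmless f
    rightMoveHarmless zero = harmless-zero
    rightMoveHarmless (suc f) = harmless-suc (harmless⇒ordered (rightMoveHarmless f)) (rightMoveHarmless f)

    valueR≤valueL : ∀ f → ValuesOrdered f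
    valueR≤valueL f = harmless⇒ordered (rightMoveHarmless f)

module Antipode where

  open Counting
  open Hypercube
  open import Data.Bool using (true; false; not; _xor_)
  open import Data.Bool.Properties using (not-involutive; not-distribˡ-xor; xor-annihilates-not; xor-inverseʳ; not-¬)
  open import Data.Nat using (ℕ; suc; _+_; _≤ᵇ_; _≡ᵇ_)
  open import Data.Nat.Properties using (+-comm)
  open import Data.Vec using (_∷_)
  open import Data.List using (map)
  open import Data.Sum using (inj₁; inj₂)
  open import Function using (_∘_)
  open import Relation.Nullary using (¬_)
  open import Relation.Binary.PropositionalEquality

  CountPreserving : ∀ k → (Vertex k → Vertex k) → Set
  CountPreserving k h = ∀ P → count (P ∘ h) (vertices k) ≡ count P (vertices k)

  count-vertices-suc : ∀ k P →
    count P (vertices (suc k)) ≡ count (P ∘ (false ∷_)) (vertices k) + count (P ∘ (true ∷_)) (vertices k)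
  count-vertices-suc k P = trans (count-++ P (map (false ∷_) (vertices k)) (map (true ∷_) (vertices k)))
                                 (cong₂ _+_ (count-map P (false ∷_) (vertices k)) (count-map P (true ∷_) (vertices k)))

  flipHead : ∀ {k} → Vertex (suc k) → Vertex (suc k)
  flipHead (a ∷ x) = not a ∷ x

  onTail : ∀ {k} → (Vertex k → Vertex k) → Vertex (suc k) → Vertex (suc k)
  onTail h (a ∷ x) = a ∷ h x

  flipHead-countPreserving : ∀ k → CountPreserving (suc k) flipHead
  flipHead-countPreserving k P = begin
    count (P ∘ flipHead) (vertices (suc k))                              ≡⟨ count-vertices-suc k (P ∘ flipHead) ⟩
    count (P ∘ (true ∷_)) (vertices k) + count (P ∘ (false ∷_)) (vertices k) ≡⟨ +-comm (count (P ∘ (true ∷_)) (vertices k)) _ ⟩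
    count (P ∘ (false ∷_)) (vertices k) + count (P ∘ (true ∷_)) (vertices k) ≡⟨ count-vertices-suc k P ⟨
    count P (vertices (suc k))                                           ∎
    where open ≡-Reasoning

  onTail-countPreserving : ∀ k h → CountPreserving k h → CountPreserving (suc k) (onTail h)
  onTail-countPreserving k h preserving P = begin
    count (P ∘ onTail h) (vertices (suc k))                                    ≡⟨ count-vertices-suc k (P ∘ onTail h) ⟩
    count (P ∘ (false ∷_) ∘ h) (vertices k) + count (P ∘ (true ∷_) ∘ h) (vertices k) ≡⟨ cong₂ _+_ (preserving _) (preserving _) ⟩
    count (P ∘ (false ∷_)) (vertices k) + count (P ∘ (true ∷_)) (vertices k)       ≡⟨ count-vertices-suc k P ⟨
    count P (vertices (suc k))                                                 ∎
    where open ≡-Reasoning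

  ∘-countPreserving : ∀ {k} g h → CountPreserving k g → CountPreserving k h → CountPreserving k (g ∘ h)
  ∘-countPreserving g h g-preserving h-preserving P = trans (h-preserving (P ∘ g)) (g-preserving P)

  module _ {m : ℕ} where

    -- Distance 3 between v and σ v makes their closed neighbourhoods disjoint; this is where n ≥ 3
    -- is needed.
    σ : Vertex (3 + m) → Vertex (3 + m)
    σ (a ∷ b ∷ c ∷ x) = not a ∷ not b ∷ not c ∷ x

    σ-countPreserving : CountPreserving (3 + m) σ
    σ-countPreserving P = trans (count-cong (vertices (3 + m)) σ≗)
      (∘-countPreserving flipHead (onTail (flipHead ∘ onTail flipHead)) (flipHead-countPreserving _)
        (onTail-countPreserving _ _ (∘-countPreserving flipHead (onTail flipHead) (flipHead-countPreserving _)
          (onTail-countPreserving _ flipHead (flipHead-countPreserving _)))) P)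
      where
      σ≗ : ∀ x → P (σ x) ≡ P (flipHead (onTail (flipHead ∘ onTail flipHead) x))
      σ≗ (a ∷ b ∷ c ∷ x) = refl

    σ-involutive : ∀ v → σ (σ v) ≡ v
    σ-involutive (a ∷ b ∷ c ∷ x) rewrite not-involutive a | not-involutive b | not-involutive c = refl

    hamming-σ : ∀ u v → hamming (σ u) (σ v) ≡ hamming u v
    hamming-σ (a ∷ b ∷ c ∷ x) (a′ ∷ b′ ∷ c′ ∷ x′)
      rewrite xor-annihilates-not a a′ | xor-annihilates-not b b′ | xor-annihilates-not c c′ = refl

    black-σ : ∀ v → black (σ v) ≡ not (black v)
    black-σ (a ∷ b ∷ c ∷ x) = begin
      not a xor (not b xor (not c xor black x))   ≡⟨ cong (λ t → not a xor (not b xor t)) (not-xor c (black x)) ⟩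
      not a xor (not b xor not (c xor black x))   ≡⟨ cong (not a xor_) (xor-annihilates-not b (c xor black x)) ⟩
      not a xor (b xor (c xor black x))           ≡⟨ not-xor a (b xor (c xor black x)) ⟩
      not (a xor (b xor (c xor black x)))         ∎
      where
      open ≡-Reasoning
      not-xor : ∀ a y → not a xor y ≡ not (a xor y)
      not-xor a y = sym (not-distribˡ-xor a y)

    hamming-v-σv : ∀ v → hamming v (σ v) ≡ 3
    hamming-v-σv (a ∷ b ∷ c ∷ x)
      rewrite xor-inverseʳ a | xor-inverseʳ b | xor-inverseʳ c | hamming-self x = refl

    ∼-σ : ∀ {u v} → u ∼ v → σ u ∼ σ v
    ∼-σ {u} {v} (adj u∼v) = adj (trans (cong (_≡ᵇ 1) (hamming-σ u v)) u∼v)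

    ∈N-σ : ∀ {u v} → u ∈N[ v ] → σ u ∈N[ σ v ]
    ∈N-σ {u} {v} (nbhd u∈Nv) = nbhd (trans (cong (_≤ᵇ 1) (hamming-σ u v)) u∈Nv)

    v≁σv : ∀ v → ¬ v ∼ σ v
    v≁σv v (adj v∼σv) with () ← trans (sym (cong (_≡ᵇ 1) (hamming-v-σv v))) v∼σv

    ∈N-disjoint : ∀ {v x} → x ∈N[ v ] → ¬ x ∈N[ σ v ]
    ∈N-disjoint {v} x∈Nv x∈Nσv with ∈N⇒≡⊎∼ x∈Nv | ∈N⇒≡⊎∼ x∈Nσv
    ... | inj₁ refl | inj₁ v≡σv = not-¬ (sym (cong black v≡σv)) (black-σ v)
    ... | inj₁ refl | inj₂ v∼σv = v≁σv v v∼σv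
    ... | inj₂ σv∼v | inj₁ refl = v≁σv v (∼-sym σv∼v)
    ... | inj₂ x∼v  | inj₂ x∼σv =
      not-¬ (trans (sym (black-∼ x∼v)) (trans (black-∼ x∼σv) (cong not (black-σ v)))) (sym (not-involutive _))

module MirrorStrategy where

  open Counting
  open Hypercube
  open Positions
  open ScoringGames
  open InfluenceValues
  open InfluenceNonzugzwang
  open Antipode
  open import Data.Bool using (not; _∧_)
  open import Data.Bool.Properties using (not-¬)
  open import Data.Nat using (ℕ; zero; suc; _+_) renaming (_≤_ to _≤ℕ_)
  import Data.Nat.Properties as ℕ
  open import Data.Integer using (+_; -_; _≤_) renaming (_+_ to _+ℤ_)
  open import Data.Integer.Properties using (≤-refl; +-inverseʳ; +-inverseˡ)
  open import Data.List.Membership.Propositional using (_∈_)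
  open import Data.List.Membership.Propositional.Properties using (∈-map⁻)
  open import Data.Product using (_×_; _,_; ∃; ∃₂; proj₁; proj₂)
  open import Data.Sum using (inj₁; inj₂)
  open import Data.Empty using (⊥; ⊥-elim)
  open import Function using (_∘_)
  open import Relation.Nullary using (¬_)
  open import Relation.Binary.PropositionalEquality

  module _ {m : ℕ} where

    σ-Invariant : Position {3 + m} → Set
    σ-Invariant P = ∀ x → P (σ x) ≡ P x

    σ-∈ : ∀ {P : Position {3 + m}} {v} → σ-Invariant P → v ∈ₚ P → σ v ∈ₚ P
    σ-∈ {v = v} inv ⟨ Pv ⟩ = ⟨ trans (inv v) Pv ⟩

    σ-reply-legal : ∀ {P : Position {3 + m}} {v} → σ-Invariant P → IsolateFree P → v ∈ₚ P → σ v ∈ₚ play v P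
    σ-reply-legal {P} {v} inv isolateFree v∈P =
      let (z , z∈P , σv∼z) = isolateFree (σ v) (σ-∈ inv v∈P)
      in dropIsolated⁺ {P = delete v P} (delete⁺ (σ-∈ inv v∈P) (λ σv∈Nv → ∈N-disjoint σv∈Nv (∈N-refl (σ v))))
                       (delete⁺ z∈P (λ z∈Nv → ∈N-disjoint z∈Nv (∼⇒∈N (∼-sym σv∼z)))) σv∼z

    play-σ : ∀ v (P : Position {3 + m}) → (play v P ∘ σ) ≗ play (σ v) (P ∘ σ)
    play-σ v P = ⊆ₚ-antisym ⊆ ⊇
      where
      σ⁻¹-∈N : ∀ {v y} → σ y ∈N[ v ] → y ∈N[ σ v ]
      σ⁻¹-∈N {v} {y} σy∈Nv = subst (_∈N[ σ v ]) (σ-involutive y) (∈N-σ σy∈Nv)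
      σ-∈N : ∀ {v y} → y ∈N[ σ v ] → σ y ∈N[ v ]
      σ-∈N {v} {y} y∈Nσv = subst (σ y ∈N[_]) (σ-involutive v) (∈N-σ y∈Nσv)
      ⊆ : (play v P ∘ σ) ⊆ₚ play (σ v) (P ∘ σ)
      ⊆ y ⟨ h ⟩ =
        let (x , x∈ , σy∼x) = dropIsolated-neighbour {P = delete v P} {u = σ y} ⟨ h ⟩ in
        dropIsolated⁺ {P = delete (σ v) (P ∘ σ)}
                      (delete⁺ ⟨ holds (play⁻ {v = v} ⟨ h ⟩) ⟩ (λ y∈N → play-far {v = v} ⟨ h ⟩ (σ-∈N y∈N)))
                      (delete⁺ ⟨ trans (cong P (σ-involutive x)) (holds (delete⁻ x∈)) ⟩
                               (λ σx∈N → delete-far x∈ (subst (_∈N[ v ]) (σ-involutive x) (σ-∈N σx∈N))))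
                      (subst (_∼ σ x) (σ-involutive y) (∼-σ σy∼x))
      ⊇ : play (σ v) (P ∘ σ) ⊆ₚ (play v P ∘ σ)
      ⊇ y y∈ =
        let (x , x∈ , y∼x) = dropIsolated-neighbour {P = delete (σ v) (P ∘ σ)} y∈ in
        ⟨ holds (dropIsolated⁺ {P = delete v P}
                               (delete⁺ ⟨ holds (play⁻ {v = σ v} y∈) ⟩ (λ σy∈N → play-far y∈ (σ⁻¹-∈N σy∈N)))
                               (delete⁺ ⟨ holds (delete⁻ x∈) ⟩ (λ σx∈N → delete-far x∈ (σ⁻¹-∈N σx∈N)))
                               (∼-σ y∼x)) ⟩

    play-σ-invariant : ∀ {P : Position {3 + m}} v → σ-Invariant P → (play v P ∘ σ) ≗ play (σ v) P
    play-σ-invariant {P} v inv y = trans (play-σ v P y) (play-cong (σ v) inv y)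

    σ-Invariant-play-σ-play : ∀ {P : Position {3 + m}} v → σ-Invariant P → σ-Invariant (play (σ v) (play v P))
    σ-Invariant-play-σ-play {P} v inv y = begin
      play (σ v) (play v P) (σ y)              ≡⟨ play-σ (σ v) (play v P) y ⟩
      play (σ (σ v)) (play v P ∘ σ) y          ≡⟨ play-cong (σ (σ v)) (play-σ-invariant v inv) y ⟩
      play (σ (σ v)) (play (σ v) P) y          ≡⟨ cong (λ u → play u (play (σ v) P) y) (σ-involutive v) ⟩
      play v (play (σ v) P) y                  ≡⟨ play-comm v (σ v) P y ⟩
      play (σ v) (play v P) y                  ∎
      where open ≡-Reasoning

    removedBy-σ⊆ : ∀ {P : Position {3 + m}} {v} → σ-Invariant P → IsolateFree P → v ∈ₚ P →
                   removedBy (σ v) P ⊆ₚ removedBy (σ v) (play v P)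
    removedBy-σ⊆ {P} {v} inv isolateFree v∈P y y∈ = removedBy⁺ {v = σ v} {P = play v P} y∈Pv y∉Pvσv
      where
      y∈P : y ∈ₚ P
      y∈P = proj₁ (removedBy⁻ {v = σ v} {P = P} y∈)
      y∉Pσv : ¬ y ∈ₚ play (σ v) P
      y∉Pσv = proj₂ (removedBy⁻ {v = σ v} {P = P} y∈)
      σv∈P : σ v ∈ₚ P
      σv∈P = σ-∈ inv v∈P
      y∉Pvσv : ¬ y ∈ₚ play (σ v) (play v P)
      y∉Pvσv y∈Pvσv =
        let (z , z∈ , y∼z) = dropIsolated-neighbour {P = delete (σ v) (delete v P)}
                               (≗⇒⊆ₚ {P = play (σ v) (play v P)} (play-play (σ v) v P) y y∈Pvσv)
        in y∉Pσv (dropIsolated⁺ {P = delete (σ v) P} (delete⁺ y∈P (play-far {v = σ v} {P = play v P} y∈Pvσv))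
                                (delete⁺ (delete⁻ {v = v} (delete⁻ {v = σ v} z∈)) (delete-far {v = σ v} z∈)) y∼z)
      neighbourNearσv : y ∈N[ σ v ] → ∃ λ z → z ∈ₚ P × y ∼ z × z ∈N[ σ v ]
      neighbourNearσv y∈Nσv with ∈N⇒≡⊎∼ y∈Nσv
      ... | inj₁ refl = let (z , z∈P , σv∼z) = isolateFree (σ v) σv∈P in z , z∈P , σv∼z , ∼⇒∈N (∼-sym σv∼z)
      ... | inj₂ y∼σv = σ v , σv∈P , y∼σv , ∈N-refl (σ v)
      y∈Pv : y ∈ₚ play v P
      y∈Pv with ∈N? y (σ v)
      ... | inj₁ y∈Nσv =
        let (z , z∈P , y∼z , z∈Nσv) = neighbourNearσv y∈Nσv
        in dropIsolated⁺ {P = delete v P} (delete⁺ y∈P (λ y∈Nv → ∈N-disjoint y∈Nv y∈Nσv))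
                         (delete⁺ z∈P (λ z∈Nv → ∈N-disjoint z∈Nv z∈Nσv)) y∼z
      ... | inj₂ y∉Nσv =
        let (z , z∈P , y∼z) = isolateFree y y∈P
        in dropIsolated⁺ {P = delete v P} (delete⁺ y∈P y∉Nv) (delete⁺ z∈P (λ z∈Nv → ∈N-disjoint z∈Nv (nearσv z∈P y∼z))) y∼z
        where
        nearσv : ∀ {z} → z ∈ₚ P → y ∼ z → z ∈N[ σ v ]
        nearσv {z} z∈P y∼z with ∈N? z (σ v)
        ... | inj₁ z∈Nσv = z∈Nσv
        ... | inj₂ z∉Nσv = ⊥-elim (y∉Pσv (dropIsolated⁺ {P = delete (σ v) P} (delete⁺ y∈P y∉Nσv) (delete⁺ z∈P z∉Nσv) y∼z))
        y∉Nv : ¬ y ∈N[ v ]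
        y∉Nv y∈Nv with ∈N⇒≡⊎∼ y∈Nv
        ... | inj₁ refl =
          let (z′ , z′∈P , v∼z′) = isolateFree v v∈P in ∈N-disjoint (∼⇒∈N (∼-sym v∼z′)) (nearσv z′∈P v∼z′)
        ... | inj₂ y∼v = ∈N-disjoint (∈N-refl v) (nearσv v∈P y∼v)

    -- A vertex removed by σ v only after v has a neighbour next to v and one next to σ v (otherwise
    -- it would be removed already): these neighbours would have different colours.
    removedBy-σ⊇ : ∀ {P : Position {3 + m}} {v} → removedBy (σ v) (play v P) ⊆ₚ removedBy (σ v) P
    removedBy-σ⊇ {P} {v} y y∈ = removedBy⁺ {v = σ v} {P = P} (play⁻ {v = v} y∈Pv) y∉Pσv
      where
      y∈Pv : y ∈ₚ play v P
      y∈Pv = proj₁ (removedBy⁻ {v = σ v} {P = play v P} y∈)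
      y∉Pvσv : ¬ y ∈ₚ play (σ v) (play v P)
      y∉Pvσv = proj₂ (removedBy⁻ {v = σ v} {P = play v P} y∈)
      y∉Nv : ¬ y ∈N[ v ]
      y∉Nv = play-far {v = v} y∈Pv
      survives : ∀ {z} → ¬ y ∈N[ σ v ] → y ∼ z → z ∈ₚ P → ¬ z ∈N[ v ] → ¬ z ∈N[ σ v ] → y ∈ₚ play (σ v) (play v P)
      survives y∉Nσv y∼z z∈P z∉Nv z∉Nσv = ≗⇒⊆ₚ {Q = play (σ v) (play v P)} (λ x → sym (play-play (σ v) v P x)) y
        (dropIsolated⁺ {P = delete (σ v) (delete v P)} (delete⁺ (delete⁺ (play⁻ {v = v} y∈Pv) y∉Nv) y∉Nσv)
                       (delete⁺ (delete⁺ z∈P z∉Nv) z∉Nσv) y∼z)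
      neighbours-far : ∀ {z z′} → ¬ y ∈N[ σ v ] → y ∼ z → z ∈ₚ delete (σ v) P → y ∼ z′ → z′ ∈ₚ delete v P → ⊥
      neighbours-far {z} {z′} y∉Nσv y∼z z∈ y∼z′ z′∈ with ∈N? z v | ∈N? z′ (σ v)
      ... | inj₂ z∉Nv | _ = y∉Pvσv (survives y∉Nσv y∼z (delete⁻ {v = σ v} z∈) z∉Nv (delete-far {v = σ v} z∈))
      ... | _ | inj₂ z′∉Nσv = y∉Pvσv (survives y∉Nσv y∼z′ (delete⁻ {v = v} z′∈) (delete-far {v = v} z′∈) z′∉Nσv)
      ... | inj₁ z∈Nv | inj₁ z′∈Nσv =
        not-¬ (sym (trans (sym (black-∼∈N y∼z z∈Nv y∉Nv)) (black-∼∈N y∼z′ z′∈Nσv y∉Nσv))) (black-σ v)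
      y∉Pσv : ¬ y ∈ₚ play (σ v) P
      y∉Pσv y∈Pσv =
        let (z , z∈ , y∼z) = dropIsolated-neighbour {P = delete (σ v) P} y∈Pσv
            (z′ , z′∈ , y∼z′) = dropIsolated-neighbour {P = delete v P} y∈Pv
        in neighbours-far (play-far {v = σ v} y∈Pσv) y∼z z∈ y∼z′ z′∈

    -- By symmetry σ v removes from P as many vertices as v does; after v it removes the same ones.
    gain-σ-reply : ∀ {P : Position {3 + m}} {v} → σ-Invariant P → IsolateFree P → v ∈ₚ P → gain v P ≡ gain (σ v) (play v P)
    gain-σ-reply {P} {v} inv isolateFree v∈P = begin
      gain v P                                                 ≡⟨ gain≡removedBy v P ⟩
      + count (removedBy v P) (vertices (3 + m))               ≡⟨ cong +_ (σ-countPreserving (removedBy v P)) ⟨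
      + count (removedBy v P ∘ σ) (vertices (3 + m))           ≡⟨ cong +_ (count-cong (vertices (3 + m)) σ-image) ⟩
      + count (removedBy (σ v) P) (vertices (3 + m))           ≡⟨ cong +_ (count-cong (vertices (3 + m)) after-v) ⟩
      + count (removedBy (σ v) (play v P)) (vertices (3 + m))  ≡⟨ gain≡removedBy (σ v) (play v P) ⟨
      gain (σ v) (play v P)                                    ∎
      where
      open ≡-Reasoning
      σ-image : ∀ y → removedBy v P (σ y) ≡ removedBy (σ v) P y
      σ-image y = cong₂ (λ a b → a ∧ not b) (inv y) (play-σ-invariant v inv y)
      after-v : removedBy (σ v) P ≗ removedBy (σ v) (play v P)
      after-v = ⊆ₚ-antisym (removedBy-σ⊆ inv isolateFree v∈P) (removedBy-σ⊇ {P} {v})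

    removed-σ-reply : ∀ {P : Position {3 + m}} {v} → σ-Invariant P → IsolateFree P → v ∈ₚ P →
                      + removed v (listOf P) ≡ + removed (σ v) (listOf (play v P))
    removed-σ-reply {P} {v} inv isolateFree v∈P =
      trans (removed≡gain v P) (trans (gain-σ-reply inv isolateFree v∈P) (sym (removed≡gain (σ v) (play v P))))

    mutual
      mirror-game : ∀ k (P : Position {3 + m}) → σ-Invariant P → IsolateFree P → size P ≤ℕ k → Mirror (game k P)
      mirror-game zero P _ _ _ = mirror (λ ()) (λ ()) ≤-refl
      mirror-game (suc k) P inv isolateFree P≤ rewrite game-suc k P = mirror answerLeft answerRight Rs≤Ls
        where
        Rs≤Ls : Rs (mk (leftMoves k P) (rightMoves k P)) ≤ Ls (mk (leftMoves k P) (rightMoves k P))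
        Rs≤Ls rewrite sym (game-suc k P) | Rs-game (suc k) P P≤ | Ls-game (suc k) P P≤ = valueR≤valueL (suc k) P P≤
        answerLeft : ∀ {d g} → (d , g) ∈ leftMoves k P → ∃₂ λ e g′ → (e , g′) ∈ rightOptions g × d +ℤ e ≡ + 0 × Mirror g′
        answerLeft d,g∈ with ∈-map⁻ (leftMove k P) d,g∈
        ... | v , v∈ , refl with v∈P , bv ← ∈-listOf⁻ v∈ with σ-reply k P inv isolateFree P≤ v∈P
        ...   | k′ , refl , σv∈Pv , m′ = _ , _ , reply∈ , scores-cancel , m′
          where
          reply∈ : rightMove k′ (play v P) (σ v) ∈ rightOptions (game (suc k′) (play v P))
          reply∈ = rightMove∈ σv∈Pv (trans (black-σ v) (cong not bv))
          scores-cancel : + removed v (listOf P) +ℤ - + removed (σ v) (listOf (play v P)) ≡ + 0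
          scores-cancel = trans (cong (λ r → r +ℤ - + removed (σ v) (listOf (play v P))) (removed-σ-reply inv isolateFree v∈P))
                                (+-inverseʳ (+ removed (σ v) (listOf (play v P))))
        answerRight : ∀ {d g} → (d , g) ∈ rightMoves k P → ∃₂ λ e g′ → (e , g′) ∈ leftOptions g × d +ℤ e ≡ + 0 × Mirror g′
        answerRight d,g∈ with ∈-map⁻ (rightMove k P) d,g∈
        ... | v , v∈ , refl with v∈P , wv ← ∈-listOf⁻ v∈ with σ-reply k P inv isolateFree P≤ v∈P
        ...   | k′ , refl , σv∈Pv , m′ = _ , _ , reply∈ , scores-cancel , m′
          where
          reply∈ : leftMove k′ (play v P) (σ v) ∈ leftOptions (game (suc k′) (play v P))
          reply∈ = leftMove∈ σv∈Pv (trans (black-σ v) wv)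
          scores-cancel : - + removed v (listOf P) +ℤ + removed (σ v) (listOf (play v P)) ≡ + 0
          scores-cancel = trans (cong (λ r → - r +ℤ + removed (σ v) (listOf (play v P))) (removed-σ-reply inv isolateFree v∈P))
                                (+-inverseˡ (+ removed (σ v) (listOf (play v P))))

      σ-reply : ∀ k (P : Position {3 + m}) → σ-Invariant P → IsolateFree P → size P ≤ℕ suc k → ∀ {v} → v ∈ₚ P →
                ∃ λ k′ → k ≡ suc k′ × σ v ∈ₚ play v P × Mirror (game k′ (play (σ v) (play v P)))
      σ-reply zero P inv isolateFree P≤1 v∈P =
        ⊥-elim (ℕ.n≮0 (ℕ.<-≤-trans (size-play< (σ-reply-legal inv isolateFree v∈P)) (size-play≤pred P≤1 v∈P)))
      σ-reply (suc k′) P inv isolateFree P≤ {v} v∈P =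
        k′ , refl , σv∈Pv , mirror-game k′ _ (σ-Invariant-play-σ-play v inv) (dropIsolated-isolateFree _)
                                           (size-play≤pred (size-play≤pred P≤ v∈P) σv∈Pv)
        where
        σv∈Pv : σ v ∈ₚ play v P
        σv∈Pv = σ-reply-legal inv isolateFree v∈P

open Counting
open Positions
open ScoringGames
open InfluenceValues
open MirrorStrategy
open import Data.Nat using (ℕ; _+_; _≤_; s≤s; z≤n)
open import Data.List using (length)
open import Data.Bool using (true)
open import Relation.Binary.PropositionalEquality

proposition3 : (n : ℕ) → 3 ≤ n → IsZero (H n)
proposition3 _ (s≤s (s≤s (s≤s {n = m} z≤n))) = mirror⇒IsZero (subst Mirror game≡H mirror-H)
  where
  N : ℕ
  N = length (vertices (3 + m))
  mirror-H : Mirror (game N (λ _ → true))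
  mirror-H = mirror-game N (λ _ → true) (λ _ → refl) whole-isolateFree (count≤length _ (vertices (3 + m)))
  game≡H : game N (λ _ → true) ≡ H (3 + m)
  game≡H = cong (influence N) (filterᵇ-true (vertices (3 + m)))
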